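{- Let $k\ge1$, $\ell_1,\dots,\ell_k\ge1$, and let $\mathbf c^{(1)},\dots,\mathbf c^{(k+1)}$ be compositions with $\mathbf c^{(k+1)}\ne\epsilon$. Put $L=\sum_{i=1}^k\ell_i$ and $N=3L+\sum_{i=1}^{k+1}|\mathbf c^{(i)}|$. Then $$\mathrm P\big(\mathbf c^{(1)}\oplus(3^{\ell_1})\oplus\mathbf c^{(2)}\oplus(3^{\ell_2})\oplus\cdots\oplus\mathbf c^{(k)}\oplus(3^{\ell_k})\oplus\mathbf c^{(k+1)}\big)=\left(\frac13\right)^{L-k}\frac{N!}{(1+|\mathbf c^{(1)}|)!\,\Big(\prod_{i=2}^k(3+|\mathbf c^{(i)}|)!\Big)\,(|\mathbf c^{(k+1)}|+2)!}\;\mathrm P(\mathbf c^{(1)}\oplus(1))\left(\prod_{i=2}^{k}\mathrm P((2)\oplus\mathbf c^{(i)}\oplus(1))\right)\mathrm P((2)\oplus\mathbf c^{(k+1)}).$$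
   Context: Permutations $\sigma\in\mathcal S_n$ are words $\sigma_1\cdots\sigma_n$; $i$ is a peak if $\sigma_{i-1}<\sigma_i>\sigma_{i+1}$. A composition of $n$ is a finite sequence of positive integers summing to $n$; $|\mathbf c|$ is its size; $\epsilon$ is the empty composition, $|\epsilon|=0$. If the peak set of $\sigma\in\mathcal S_n$ is $\{i_1<\dots<i_k\}$, its peak-composition is $(c_1,\dots,c_{k+1})$, $c_j=i_j-i_{j-1}$, $i_0=0$, $i_{k+1}=n$. $\mathrm P(\mathbf c)$ is the number of $\sigma\in\mathcal S_{|\mathbf c|}$ with peak-composition $\mathbf c$. $\oplus$ is concatenation with identity $\epsilon$; $(3^{\ell})$ is the composition with $\ell$ parts all equal to $3$. -}

module Defs where

open import Data.Nat using (ℕ; zero; suc; _+_; _*_; _∸_; _<_; _<?_)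
open import Data.Nat.Properties using (_≟_)
open import Data.Bool using (Bool; true; false; _∧_; if_then_else_)
open import Data.Fin using (Fin; zero; suc)
open import Data.List using (List; []; _∷_; _++_; [_]; length; filter; map; concatMap; replicate)
open import Data.Nat.ListAction using (sum)
open import Data.List.Properties using (≡-dec)
open import Data.List.Relation.Unary.All using (All)
open import Data.List.Relation.Unary.Unique.DecPropositional _≟_ using (unique?)
open import Relation.Nullary.Decidable using (⌊_⌋)

Composition : Set
Composition = List ℕ

IsComposition : Composition → Set
IsComposition c = All (λ x → 0 < x) c

size : Composition → ℕ
size = sum

-- concatenation ⊕ is list append _++_, ε is []

threes : ℕ → Composition
threes ℓ = replicate ℓ 3

words : ℕ → ℕ → List (List ℕ)
words n zero = [] ∷ []
words n (suc m) = concatMap (λ a → map (a ∷_) (words n m)) (Data.List.upTo n)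
  where import Data.List

-- S_n : permutations of {1,…,n} as words σ₁⋯σₙ (words of length n over {1..n}
-- with no repeated letter)
perms : ℕ → List (List ℕ)
perms n = filter unique? (words′ n)
  where
  words′ : ℕ → List (List ℕ)
  words′ n = Data.List.map (Data.List.map suc) (words n n)
    where import Data.List

-- peak positions (1-indexed); i is the position of the second letter
peaksFrom : ℕ → List ℕ → List ℕ
peaksFrom i (a ∷ b ∷ c ∷ rest) =
  (if ⌊ a <? b ⌋ ∧ ⌊ c <? b ⌋ then i ∷ peaksFrom (suc i) (b ∷ c ∷ rest)
   else peaksFrom (suc i) (b ∷ c ∷ rest))
peaksFrom i _ = []

peakSet : List ℕ → List ℕ
peakSet σ = peaksFrom 2 σ

diffs : ℕ → List ℕ → List ℕ
diffs prev [] = []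
diffs prev (x ∷ xs) = (x ∸ prev) ∷ diffs x xs

peakComp : List ℕ → Composition
peakComp σ = diffs 0 (peakSet σ ++ [ length σ ])

P : Composition → ℕ
P c = length (filter (λ σ → ≡-dec _≟_ (peakComp σ) c) (perms (size c)))

sumF : (n : ℕ) → (Fin n → ℕ) → ℕ
sumF zero f = 0
sumF (suc n) f = f zero + sumF n (λ i → f (suc i))

prodF : (n : ℕ) → (Fin n → ℕ) → ℕ
prodF zero f = 1
prodF (suc n) f = f zero * prodF n (λ i → f (suc i))

concatF : (n : ℕ) → (Fin n → List ℕ) → List ℕ
concatF zero f = []
concatF (suc n) f = f zero ++ concatF n (λ i → f (suc i))

-- The whole proposition rests on one gluing identity (`P-glue`): for d ≠ ε,
--   (|c|+1)! (|d|+2)! P(c ⊕ (3) ⊕ d) = (|c|+|d|+3)! P(c ⊕ (1)) P((2) ⊕ d).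
-- Combinatorially, σ has peak composition c ⊕ (3) ⊕ d exactly when its first
-- |c|+1 letters have peak composition c ⊕ (1) and the remaining letters have
-- (2) ⊕ d (`peakComp-glue`); since peaks only see relative order, counting
-- such σ is a "shuffle" count (`shuffle`), proved by double counting triples
-- (σ, ρ₁, ρ₂) ∈ S_N × S_{n₁} × S_{n₂} with the help of |S_n| = n!.
--
-- Applying it with c = (2) gives
-- 3 (|d|+2)! P((2,3) ⊕ d) = (|d|+5)! P((2) ⊕ d), hence a factor 3^j for each
-- run of j threes after a 2 (`P-prepend-threes`); together they peel off the
-- first block (`first-block`), and induction on k finishes the proof.

module Submission where

open import Defs
open import Data.Bool using (true; false; _∧_; if_then_else_)
open import Data.Empty using (⊥-elim)
open import Data.Fin using (Fin; zero; suc; inject₁; fromℕ)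
open import Data.List hiding (sum; find)
open import Data.List.Properties hiding (sum-++)
open import Data.List.Membership.Propositional using (_∈_; find; lose)
open import Data.List.Membership.Propositional.Properties
open import Data.List.Relation.Unary.Any using (here; there)
open import Data.List.Relation.Unary.All as All using (All; []; _∷_)
import Data.List.Relation.Unary.All.Properties as AllP
open import Data.List.Relation.Unary.AllPairs using ([]; _∷_)
open import Data.List.Relation.Unary.Unique.Propositional using (Unique)
import Data.List.Relation.Unary.Unique.Propositional.Properties as UP
open import Data.List.Relation.Binary.Permutation.Propositional using (_↭_; prep; ↭-trans; ↭-sym; ↭-refl)
open import Data.List.Relation.Binary.Permutation.Propositional.Properties using (shift; map⁺; ∈-resp-↭)
open import Data.Nat
open import Data.Nat.Properties
open import Data.Nat.ListAction using (sum)
open import Data.List.Relation.Unary.Unique.DecPropositional _≟_ using (unique?)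
open import Data.Nat.ListAction.Properties using (sum-↭; sum-++)
open import Data.Nat.Tactic.RingSolver using (solve-∀)
open import Data.Product using (Σ; ∃; _×_; _,_; proj₁; proj₂)
open import Data.Sum using (inj₁; inj₂)
open import Data.Unit using (⊤; tt)
open import Function using (_∘_)
open import Relation.Binary using (tri<; tri≈; tri>)
open import Relation.Binary.PropositionalEquality hiding ([_])
open import Relation.Nullary using (¬_; Dec; yes; no)
open import Relation.Nullary.Decidable using (⌊_⌋)
open import Relation.Unary using (Decidable)

private variable A B : Set

∈-remove : ∀ {x y : A} as bs → x ∈ as ++ y ∷ bs → x ≢ y → x ∈ as ++ bs
∈-remove []       bs (here x≡y) x≢y = ⊥-elim (x≢y x≡y)
∈-remove []       bs (there x∈) x≢y = x∈
∈-remove (a ∷ as) bs (here x≡a) x≢y = here x≡a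
∈-remove (a ∷ as) bs (there x∈) x≢y = there (∈-remove as bs x∈ x≢y)

length-remove : ∀ (as bs : List A) y → length (as ++ y ∷ bs) ≡ suc (length (as ++ bs))
length-remove []       bs y = refl
length-remove (a ∷ as) bs y = cong suc (length-remove as bs y)

⊆-remove : ∀ {y : A} {ys} as bs → All (y ≢_) ys → (∀ {z} → z ∈ ys → z ∈ as ++ y ∷ bs) →
  ∀ {z} → z ∈ ys → z ∈ as ++ bs
⊆-remove as bs y∉ys ⊆ z∈ = ∈-remove as bs (⊆ z∈) (λ z≡y → All.lookup y∉ys z∈ (sym z≡y))

unique-length-≤ : {ys xs : List A} → Unique ys → (∀ {z} → z ∈ ys → z ∈ xs) → length ys ≤ length xs
unique-length-≤ {ys = []}     _          _ = z≤n
unique-length-≤ {ys = y ∷ ys} (y∉ ∷ uys) ⊆ with ∈-∃++ (⊆ (here refl))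
... | as , bs , refl = subst (_ ≤_) (sym (length-remove as bs y))
        (s≤s (unique-length-≤ uys (⊆-remove as bs y∉ (⊆ ∘ there))))

unique⇒↭ : {ys xs : List A} → Unique ys → (∀ {z} → z ∈ ys → z ∈ xs) → length ys ≡ length xs → ys ↭ xs
unique⇒↭ {ys = []}     {[]}    _ _ _ = ↭-refl
unique⇒↭ {ys = []}     {_ ∷ _} _ _ ()
unique⇒↭ {ys = y ∷ ys} (y∉ ∷ uys) ⊆ len with ∈-∃++ (⊆ (here refl))
... | as , bs , refl =
  ↭-trans (prep y (unique⇒↭ uys (⊆-remove as bs y∉ (⊆ ∘ there)) (suc-injective (trans len (length-remove as bs y)))))
          (↭-sym (shift y as bs))

unique-⊆-complete : {ys xs : List A} → Unique ys → (∀ {z} → z ∈ ys → z ∈ xs) → length ys ≡ length xs →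
  ∀ {z} → z ∈ xs → z ∈ ys
unique-⊆-complete uys ⊆ len = ∈-resp-↭ (↭-sym (unique⇒↭ uys ⊆ len))

map-unique : ∀ {f : A → B} {xs} → Unique xs → (∀ {x y} → x ∈ xs → y ∈ xs → f x ≡ f y → x ≡ y) → Unique (map f xs)
map-unique []         inj = []
map-unique (x∉ ∷ uxs) inj =
  AllP.map⁺ (All.tabulate (λ z∈ fx≡fz → All.lookup x∉ z∈ (inj (here refl) (there z∈) fx≡fz)))
  ∷ map-unique uxs (λ x∈ y∈ → inj (there x∈) (there y∈))

sum-reindex : ∀ (h : A → ℕ) (f : A → A) {xs} → Unique xs → (∀ {x} → x ∈ xs → f x ∈ xs) →
  (∀ {x y} → x ∈ xs → y ∈ xs → f x ≡ f y → x ≡ y) → sum (map (h ∘ f) xs) ≡ sum (map h xs)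
sum-reindex h f {xs} uxs into inj = trans (cong sum (map-∘ {g = h} {f = f} xs))
  (sum-↭ (map⁺ h (unique⇒↭ (map-unique uxs inj) image⊆ (length-map f xs))))
  where
  image⊆ : ∀ {z} → z ∈ map f xs → z ∈ xs
  image⊆ z∈ with ∈-map⁻ f z∈
  ... | x , x∈ , refl = into x∈

map-injective-on : ∀ {f : A → B} {xs ys} → (∀ {x y} → x ∈ xs → y ∈ ys → f x ≡ f y → x ≡ y) →
  map f xs ≡ map f ys → xs ≡ ys
map-injective-on {xs = []}     {[]}     inj eq = refl
map-injective-on {xs = x ∷ xs} {y ∷ ys} inj eq =
  cong₂ _∷_ (inj (here refl) (here refl) (∷-injectiveˡ eq))
            (map-injective-on (λ x∈ y∈ → inj (there x∈) (there y∈)) (∷-injectiveʳ eq))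

map-≡⇒pointwise : ∀ {f g : A → B} {xs x} → map f xs ≡ map g xs → x ∈ xs → f x ≡ g x
map-≡⇒pointwise {xs = x ∷ xs} eq (here refl) = ∷-injectiveˡ eq
map-≡⇒pointwise {xs = x ∷ xs} eq (there x∈) = map-≡⇒pointwise (∷-injectiveʳ eq) x∈

sum-cong : ∀ {f g : A → ℕ} {xs} → (∀ {x} → x ∈ xs → f x ≡ g x) → sum (map f xs) ≡ sum (map g xs)
sum-cong {xs = []}     f≗g = refl
sum-cong {xs = x ∷ xs} f≗g = cong₂ _+_ (f≗g (here refl)) (sum-cong (f≗g ∘ there))

sum-const : ∀ (c : ℕ) (xs : List A) → sum (map (λ _ → c) xs) ≡ length xs * c
sum-const c []       = refl
sum-const c (x ∷ xs) = cong (c +_) (sum-const c xs)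

sum-+ : ∀ (f g : A → ℕ) xs → sum (map (λ x → f x + g x) xs) ≡ sum (map f xs) + sum (map g xs)
sum-+ f g []       = refl
sum-+ f g (x ∷ xs) = trans (cong (f x + g x +_) (sum-+ f g xs))
                           (interchange (f x) (g x) (sum (map f xs)) (sum (map g xs)))
  where
  interchange : ∀ a b c d → a + b + (c + d) ≡ a + c + (b + d)
  interchange = solve-∀

sum-*ˡ : ∀ (c : ℕ) (f : A → ℕ) xs → sum (map (λ x → c * f x) xs) ≡ c * sum (map f xs)
sum-*ˡ c f []       = sym (*-zeroʳ c)
sum-*ˡ c f (x ∷ xs) = trans (cong (c * f x +_) (sum-*ˡ c f xs)) (sym (*-distribˡ-+ c (f x) _))

sum-*ʳ : ∀ (c : ℕ) (f : A → ℕ) xs → sum (map (λ x → f x * c) xs) ≡ sum (map f xs) * c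
sum-*ʳ c f []       = refl
sum-*ʳ c f (x ∷ xs) = trans (cong (f x * c +_) (sum-*ʳ c f xs)) (sym (*-distribʳ-+ c (f x) _))

sum-swap : ∀ (xs : List A) (ys : List B) (f : A → B → ℕ) →
  sum (map (λ x → sum (map (f x) ys)) xs) ≡ sum (map (λ y → sum (map (λ x → f x y) xs)) ys)
sum-swap []       ys f = sym (trans (sum-const 0 ys) (*-zeroʳ (length ys)))
sum-swap (x ∷ xs) ys f = trans (cong (sum (map (f x) ys) +_) (sum-swap xs ys f))
  (sym (sum-+ (f x) (λ y → sum (map (λ x → f x y) xs)) ys))

sum-product : ∀ (xs : List A) (ys : List B) (f : A → ℕ) (g : B → ℕ) →
  sum (map (λ x → sum (map (λ y → f x * g y) ys)) xs) ≡ sum (map f xs) * sum (map g ys)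
sum-product xs ys f g = trans (sum-cong {xs = xs} (λ {x} _ → sum-*ˡ (f x) g ys)) (sum-*ʳ (sum (map g ys)) f xs)

indicator : ∀ {X : Set} → Dec X → ℕ
indicator (yes _) = 1
indicator (no _)  = 0

length-filter-indicator : ∀ {Q : A → Set} (Q? : Decidable Q) xs →
  length (filter Q? xs) ≡ sum (map (indicator ∘ Q?) xs)
length-filter-indicator Q? [] = refl
length-filter-indicator Q? (x ∷ xs) with Q? x
... | yes _ = cong suc (length-filter-indicator Q? xs)
... | no _  = length-filter-indicator Q? xs

indicator-× : ∀ {X Y Z : Set} (X? : Dec X) (Y? : Dec Y) (Z? : Dec Z) → (X → Y × Z) → (Y × Z → X) →
  indicator X? ≡ indicator Y? * indicator Z?
indicator-× (yes x) (yes y) (yes z) _ _ = refl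
indicator-× (yes x) (yes y) (no ¬z) f _ = ⊥-elim (¬z (proj₂ (f x)))
indicator-× (yes x) (no ¬y) Z?      f _ = ⊥-elim (¬y (proj₁ (f x)))
indicator-× (no ¬x) (yes y) (yes z) _ g = ⊥-elim (¬x (g (y , z)))
indicator-× (no ¬x) (yes y) (no ¬z) _ _ = refl
indicator-× (no ¬x) (no ¬y) Z?      _ _ = refl

count-mono : ∀ {P Q : A → Set} (P? : Decidable P) (Q? : Decidable Q) → (∀ {z} → P z → Q z) → ∀ zs →
  length (filter P? zs) ≤ length (filter Q? zs)
count-mono P? Q? P⇒Q [] = z≤n
count-mono P? Q? P⇒Q (z ∷ zs) with P? z | Q? z
... | yes p | yes _ = s≤s (count-mono P? Q? P⇒Q zs)
... | yes p | no ¬q = ⊥-elim (¬q (P⇒Q p))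
... | no _  | yes _ = m≤n⇒m≤1+n (count-mono P? Q? P⇒Q zs)
... | no _  | no _  = count-mono P? Q? P⇒Q zs

count-strict : ∀ {P Q : A → Set} (P? : Decidable P) (Q? : Decidable Q) → (∀ {z} → P z → Q z) → ∀ {x} zs →
  x ∈ zs → Q x → ¬ P x → length (filter P? zs) < length (filter Q? zs)
count-strict P? Q? P⇒Q (z ∷ zs) (here refl) qx ¬px with P? z | Q? z
... | yes p | _     = ⊥-elim (¬px p)
... | no _  | yes _ = s≤s (count-mono P? Q? P⇒Q zs)
... | no _  | no ¬q = ⊥-elim (¬q qx)
count-strict P? Q? P⇒Q (z ∷ zs) (there x∈) qx ¬px with P? z | Q? z
... | yes p | yes _ = s≤s (count-strict P? Q? P⇒Q zs x∈ qx ¬px)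
... | yes p | no ¬q = ⊥-elim (¬q (P⇒Q p))
... | no _  | yes _ = m≤n⇒m≤1+n (count-strict P? Q? P⇒Q zs x∈ qx ¬px)
... | no _  | no _  = count-strict P? Q? P⇒Q zs x∈ qx ¬px

count-<-length : ∀ {P : A → Set} (P? : Decidable P) → ∀ {x} zs → x ∈ zs → ¬ P x → length (filter P? zs) < length zs
count-<-length P? (z ∷ zs) (here refl) ¬px with P? z
... | yes p = ⊥-elim (¬px p)
... | no _  = s≤s (length-filter P? zs)
count-<-length P? (z ∷ zs) (there x∈) ¬px with P? z
... | yes _ = s≤s (count-<-length P? zs x∈ ¬px)
... | no _  = m≤n⇒m≤1+n (count-<-length P? zs x∈ ¬px)

InRange : ℕ → ℕ → Set
InRange n v = 0 < v × v ≤ n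

IsPerm : ℕ → List ℕ → Set
IsPerm n σ = length σ ≡ n × All (InRange n) σ × Unique σ

All-zip : ∀ {P Q R : A → Set} {xs} → All P xs → All Q xs → (∀ {v} → P v → Q v → R v) → All R xs
All-zip []       []       f = []
All-zip (p ∷ ps) (q ∷ qs) f = f p q ∷ All-zip ps qs f

words-sound : ∀ n m {w} → w ∈ words n m → length w ≡ m × All (_< n) w
words-sound n zero (here refl) = refl , []
words-sound n (suc m) {w} w∈ with find (∈-concatMap⁻ (λ a → map (a ∷_) (words n m)) {xs = upTo n} w∈)
... | a , a∈ , aw∈ with map∷⁻ aw∈
... | w′ , w′∈ , refl with words-sound n m w′∈
... | len , bounded = cong suc len , ∈-upTo⁻ a∈ ∷ bounded

words-complete : ∀ n {w} → All (_< n) w → w ∈ words n (length w)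
words-complete n []                 = here refl
words-complete n {a ∷ w} (a<n ∷ w<n) =
  ∈-concatMap⁺ (λ b → map (b ∷_) (words n (length w)))
               (lose (∈-upTo⁺ a<n) (∈-map⁺ (a ∷_) (words-complete n w<n)))

words-unique : ∀ n m → Unique (words n m)
words-unique n zero    = [] ∷ []
words-unique n (suc m) = prefix-unique (UP.upTo⁺ n) (words-unique n m)
  where
  prefix-unique : ∀ {xs : List ℕ} {W : List (List ℕ)} → Unique xs → Unique W →
    Unique (concatMap (λ a → map (a ∷_) W) xs)
  prefix-unique []                uW = []
  prefix-unique {x ∷ xs} {W} (x∉ ∷ uxs) uW =
    UP.++⁺ (UP.map⁺ ∷-injectiveʳ uW) (prefix-unique uxs uW) disjoint
    where
    disjoint : ∀ {v} → ¬ (v ∈ map (x ∷_) W × v ∈ concatMap (λ a → map (a ∷_) W) xs)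
    disjoint (v∈x , v∈xs) with map∷⁻ v∈x | find (∈-concatMap⁻ (λ a → map (a ∷_) W) {xs = xs} v∈xs)
    ... | _ , _ , refl | b , b∈ , v∈b with map∷⁻ v∈b
    ... | _ , _ , x≡b = All.lookup x∉ b∈ (∷-injectiveˡ x≡b)

perms-sound : ∀ n {σ} → σ ∈ perms n → IsPerm n σ
perms-sound n σ∈ with ∈-filter⁻ unique? {xs = map (map suc) (words n n)} σ∈
... | σ∈w , uσ with ∈-map⁻ (map suc) σ∈w
... | w , w∈ , refl with words-sound n n w∈
... | len , bounded = trans (length-map suc w) len , AllP.map⁺ (All.map (λ v<n → s≤s z≤n , v<n) bounded) , uσ

perms-complete : ∀ n {σ} → IsPerm n σ → σ ∈ perms n
perms-complete n {σ} (len , inRange , uσ) =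
  ∈-filter⁺ unique? (subst (_∈ map (map suc) (words n n)) (suc∘pred σ inRange)
    (∈-map⁺ (map suc) (subst (λ k → map pred σ ∈ words n k) (trans (length-map pred σ) len)
                             (words-complete n (pred-bounded σ inRange))))) uσ
  where
  suc∘pred : ∀ σ → All (InRange n) σ → map suc (map pred σ) ≡ σ
  suc∘pred []          []                  = refl
  suc∘pred (suc v ∷ σ) (_ ∷ inRange)       = cong (suc v ∷_) (suc∘pred σ inRange)
  pred-bounded : ∀ σ → All (InRange n) σ → All (_< n) (map pred σ)
  pred-bounded []          []                    = []
  pred-bounded (suc v ∷ σ) ((_ , v<n) ∷ inRange) = v<n ∷ pred-bounded σ inRange

perms-unique : ∀ n → Unique (perms n)
perms-unique n = UP.filter⁺ unique? (UP.map⁺ (map-injective suc-injective) (words-unique n n))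

range : ℕ → List ℕ
range n = map suc (upTo n)

range-complete : ∀ {n x} → InRange n x → x ∈ range n
range-complete {x = suc x} (_ , x<n) = ∈-map⁺ suc (∈-upTo⁺ x<n)

range-sound : ∀ {n x} → x ∈ range n → InRange n x
range-sound {n} x∈ with ∈-map⁻ suc x∈
... | y , y∈ , refl = s≤s z≤n , ∈-upTo⁻ y∈

range-unique : ∀ n → Unique (range n)
range-unique n = UP.map⁺ suc-injective (UP.upTo⁺ n)

length-range : ∀ n → length (range n) ≡ n
length-range n = trans (length-map suc (upTo n)) (length-upTo n)

length-cartesianProduct : ∀ (xs : List A) (ys : List B) → length (cartesianProduct xs ys) ≡ length xs * length ys
length-cartesianProduct []       ys = refl
length-cartesianProduct (x ∷ xs) ys =
  trans (length-++ (map (x ,_) ys)) (cong₂ _+_ (length-map _ ys) (length-cartesianProduct xs ys))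

-- A permutation of {1,…,n+1} is determined by its first letter x
-- and the standardisation of the remaining letters (close the gap at x); the
-- maps `firstAndRest` and `insertFirst` are injections in both directions
-- between S_{n+1} and {1,…,n+1} × S_n.

closeGap : ℕ → ℕ → ℕ
closeGap x v with x <? v
... | yes _ = pred v
... | no _  = v

openGap : ℕ → ℕ → ℕ
openGap x v with v <? x
... | yes _ = v
... | no _  = suc v

openGap-closeGap : ∀ {x v} → x ≢ v → openGap x (closeGap x v) ≡ v
openGap-closeGap {x} {v} x≢v with x <? v
openGap-closeGap {x} {suc v} x≢v | yes (s≤s x≤v) with v <? x
... | yes v<x = ⊥-elim (<⇒≱ v<x x≤v)
... | no _    = refl
openGap-closeGap {x} {v} x≢v | no x≮v with v <? x
... | yes _   = refl
... | no v≮x  = ⊥-elim (x≢v (≤-antisym (≮⇒≥ v≮x) (≮⇒≥ x≮v)))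

closeGap-openGap : ∀ x v → closeGap x (openGap x v) ≡ v
closeGap-openGap x v with v <? x
... | yes v<x with x <? v
...   | yes x<v = ⊥-elim (<-asym x<v v<x)
...   | no _    = refl
closeGap-openGap x v | no v≮x with x <? suc v
...   | yes _   = refl
...   | no x≮sv = ⊥-elim (x≮sv (s≤s (≮⇒≥ v≮x)))

closeGap-injective : ∀ {x a b} → x ≢ a → x ≢ b → closeGap x a ≡ closeGap x b → a ≡ b
closeGap-injective {x} {a} {b} x≢a x≢b eq = begin
  a                        ≡⟨ openGap-closeGap x≢a ⟨
  openGap x (closeGap x a) ≡⟨ cong (openGap x) eq ⟩
  openGap x (closeGap x b) ≡⟨ openGap-closeGap x≢b ⟩
  b                        ∎
  where open ≡-Reasoning

openGap-injective : ∀ {x a b} → openGap x a ≡ openGap x b → a ≡ b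
openGap-injective {x} {a} {b} eq =
  trans (sym (closeGap-openGap x a)) (trans (cong (closeGap x) eq) (closeGap-openGap x b))

closeGap-InRange : ∀ {n x v} → InRange (suc n) x → InRange (suc n) v → x ≢ v → InRange n (closeGap x v)
closeGap-InRange {n} {x} {v} (0<x , x≤) (0<v , v≤) x≢v with x <? v
closeGap-InRange {n} {x} {suc v} (0<x , _) (_ , s≤s v≤n) x≢v | yes (s≤s x≤v) = ≤-trans 0<x x≤v , v≤n
... | no x≮v = 0<v , ≤-pred (≤-trans (≤∧≢⇒< (≮⇒≥ x≮v) (x≢v ∘ sym)) x≤)

openGap-InRange : ∀ {n x v} → InRange n v → InRange (suc n) (openGap x v)
openGap-InRange {n} {x} {v} (0<v , v≤) with v <? x
... | yes _ = 0<v , m≤n⇒m≤1+n v≤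
... | no _  = s≤s z≤n , s≤s v≤

openGap-≢ : ∀ x v → x ≢ openGap x v
openGap-≢ x v with v <? x
... | yes v<x = <⇒≢ v<x ∘ sym
... | no v≮x  = <⇒≢ (s≤s (≮⇒≥ v≮x))

firstAndRest : List ℕ → ℕ × List ℕ
firstAndRest []      = 0 , []
firstAndRest (x ∷ τ) = x , map (closeGap x) τ

insertFirst : ℕ × List ℕ → List ℕ
insertFirst (x , τ) = x ∷ map (openGap x) τ

firstAndRest-into : ∀ n σ → IsPerm (suc n) σ → firstAndRest σ ∈ cartesianProduct (range (suc n)) (perms n)
firstAndRest-into n (x ∷ τ) (len , (x-in ∷ τ-in) , (x∉ ∷ uτ)) =
  ∈-cartesianProduct⁺ (range-complete x-in) (perms-complete n
    ( trans (length-map (closeGap x) τ) (suc-injective len)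
    , AllP.map⁺ (All-zip τ-in x∉ (closeGap-InRange x-in))
    , map-unique uτ (λ a∈ b∈ → closeGap-injective (All.lookup x∉ a∈) (All.lookup x∉ b∈))))

firstAndRest-injective : ∀ n σ σ′ → IsPerm (suc n) σ → IsPerm (suc n) σ′ → firstAndRest σ ≡ firstAndRest σ′ → σ ≡ σ′
firstAndRest-injective n (x ∷ τ) (x′ ∷ τ′) (_ , _ , (x∉ ∷ _)) (_ , _ , (x′∉ ∷ _)) eq with cong proj₁ eq
... | refl = cong (x ∷_) (map-injective-on (λ a∈ b∈ → closeGap-injective (All.lookup x∉ a∈) (All.lookup x′∉ b∈)) (cong proj₂ eq))

insertFirst-into : ∀ n x τ → InRange (suc n) x → IsPerm n τ → insertFirst (x , τ) ∈ perms (suc n)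
insertFirst-into n x τ x-in (len , τ-in , uτ) = perms-complete (suc n)
  ( cong suc (trans (length-map (openGap x) τ) len)
  , x-in ∷ AllP.map⁺ (All.map openGap-InRange τ-in)
  , AllP.map⁺ (All.universal (openGap-≢ x) τ) ∷ UP.map⁺ openGap-injective uτ)

insertFirst-injective : ∀ p q → insertFirst p ≡ insertFirst q → p ≡ q
insertFirst-injective (x , τ) (x′ , τ′) eq with ∷-injectiveˡ eq
... | refl = cong (x ,_) (map-injective openGap-injective (∷-injectiveʳ eq))

length-perms : ∀ n → length (perms n) ≡ n !
length-perms zero    = refl
length-perms (suc n) = begin
  length (perms (suc n))                               ≡⟨ ≤-antisym perms≤pairs pairs≤perms ⟩
  length pairs                                         ≡⟨ length-cartesianProduct (range (suc n)) (perms n) ⟩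
  length (range (suc n)) * length (perms n)            ≡⟨ cong₂ _*_ (length-range (suc n)) (length-perms n) ⟩
  suc n * n !                                          ∎
  where
  open ≡-Reasoning
  pairs = cartesianProduct (range (suc n)) (perms n)
  perms≤pairs : length (perms (suc n)) ≤ length pairs
  perms≤pairs = subst (_≤ length pairs) (length-map firstAndRest (perms (suc n)))
    (unique-length-≤ (map-unique (perms-unique (suc n)) λ {a} {b} a∈ b∈ →
        firstAndRest-injective n a b (perms-sound (suc n) a∈) (perms-sound (suc n) b∈)) image⊆)
    where
    image⊆ : ∀ {z} → z ∈ map firstAndRest (perms (suc n)) → z ∈ pairs
    image⊆ z∈ with ∈-map⁻ firstAndRest z∈
    ... | σ , σ∈ , refl = firstAndRest-into n σ (perms-sound (suc n) σ∈)
  pairs≤perms : length pairs ≤ length (perms (suc n))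
  pairs≤perms = subst (_≤ length (perms (suc n))) (length-map insertFirst pairs)
    (unique-length-≤ (map-unique (UP.cartesianProduct⁺ (range-unique (suc n)) (perms-unique n))
                                 (λ _ _ → insertFirst-injective _ _)) image⊆)
    where
    image⊆ : ∀ {z} → z ∈ map insertFirst pairs → z ∈ perms (suc n)
    image⊆ z∈ with ∈-map⁻ insertFirst z∈
    ... | (x , τ) , p∈ , refl with ∈-cartesianProduct⁻ (range (suc n)) (perms n) p∈
    ... | x∈ , τ∈ = insertFirst-into n x τ (range-sound x∈) (perms-sound n τ∈)

-- Relabelling invariance.  Such a statistic has the same total over S_n after
-- relabelling by any map f injective on {1,…,n}: composing f with its rank
-- function gives a permutation of S_n.

OrderCompatible : ℕ → (ℕ → ℕ) → (ℕ → ℕ) → Set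
OrderCompatible n f g = ∀ {x y} → InRange n x → InRange n y → (f x < f y → g x < g y) × (g x < g y → f x < f y)

Invariant : ℕ → (List ℕ → ℕ) → Set
Invariant n a = ∀ (f g : ℕ → ℕ) ρ → OrderCompatible n f g → All (InRange n) ρ → a (map f ρ) ≡ a (map g ρ)

module Rank (n : ℕ) (f : ℕ → ℕ) (f-injective : ∀ {x y} → InRange n x → InRange n y → f x ≡ f y → x ≡ y) where

  rank : ℕ → ℕ
  rank x = suc (length (filter (λ y → f y <? f x) (range n)))

  rank-InRange : ∀ {x} → InRange n x → InRange n (rank x)
  rank-InRange {x} x-in = s≤s z≤n , subst (length (filter (λ y → f y <? f x) (range n)) <_) (length-range n)
    (count-<-length (λ y → f y <? f x) (range n) (range-complete x-in) (<-irrefl refl))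

  rank-mono : ∀ {x y} → InRange n x → f x < f y → rank x < rank y
  rank-mono {x} {y} x-in fx<fy = s≤s (count-strict (λ z → f z <? f x) (λ z → f z <? f y)
    (λ fz<fx → <-trans fz<fx fx<fy) (range n) (range-complete x-in) fx<fy (<-irrefl refl))

  rank-compatible : OrderCompatible n f rank
  rank-compatible {x} {y} x-in y-in = rank-mono x-in , reflect
    where
    reflect : rank x < rank y → f x < f y
    reflect rx<ry with f x <? f y
    ... | yes fx<fy = fx<fy
    ... | no fx≮fy  = ⊥-elim (<⇒≱ rx<ry (s≤s (count-mono (λ z → f z <? f y) (λ z → f z <? f x)
                         (λ fz<fy → <-≤-trans fz<fy (≮⇒≥ fx≮fy)) (range n))))

  rank-injective : ∀ {x y} → InRange n x → InRange n y → rank x ≡ rank y → x ≡ y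
  rank-injective {x} {y} x-in y-in eq with <-cmp (f x) (f y)
  ... | tri< lt _ _ = ⊥-elim (<⇒≢ (rank-mono x-in lt) eq)
  ... | tri≈ _ fx≡fy _ = f-injective x-in y-in fx≡fy
  ... | tri> _ _ gt = ⊥-elim (<⇒≢ (rank-mono y-in gt) (sym eq))

relabel-sum : ∀ n (a : List ℕ → ℕ) → Invariant n a → (f : ℕ → ℕ) →
  (∀ {x y} → InRange n x → InRange n y → f x ≡ f y → x ≡ y) →
  sum (map (λ ρ → a (map f ρ)) (perms n)) ≡ sum (map a (perms n))
relabel-sum n a a-inv f f-injective =
  trans (sum-cong {xs = perms n} (λ ρ∈ → a-inv f rank _ rank-compatible (letters ρ∈)))
        (sum-reindex a (map rank) (perms-unique n) into injective)
  where
  open Rank n f f-injective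
  letters : ∀ {ρ} → ρ ∈ perms n → All (InRange n) ρ
  letters ρ∈ = proj₁ (proj₂ (perms-sound n ρ∈))
  into : ∀ {ρ} → ρ ∈ perms n → map rank ρ ∈ perms n
  into {ρ} ρ∈ with perms-sound n ρ∈
  ... | len , ρ-in , uρ = perms-complete n (trans (length-map rank ρ) len , AllP.map⁺ (All.map rank-InRange ρ-in) ,
        map-unique uρ (λ a∈ b∈ → rank-injective (All.lookup ρ-in a∈) (All.lookup ρ-in b∈)))
  injective : ∀ {ρ ρ′} → ρ ∈ perms n → ρ′ ∈ perms n → map rank ρ ≡ map rank ρ′ → ρ ≡ ρ′
  injective ρ∈ ρ′∈ = map-injective-on (λ a∈ b∈ → rank-injective (All.lookup (letters ρ∈) a∈) (All.lookup (letters ρ′∈) b∈))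

-- The shuffle identity.
-- Both sides count the triples (σ, ρ₁, ρ₂) ∈ S_N × S_{n₁} × S_{n₂} weighted by
-- the statistics of σ∘(ρ₁ ⊕ ρ₂): for fixed (ρ₁, ρ₂), composing with ρ₁ ⊕ ρ₂ is a
-- bijection of S_N; for fixed σ, the two halves of σ∘(ρ₁ ⊕ ρ₂) are relabellings
-- of ρ₁ and ρ₂ by injective maps.

-- Reading a word at a position (0-indexed nth, 1-indexed at).
nth : List ℕ → ℕ → ℕ
nth []       _       = 0
nth (x ∷ xs) zero    = x
nth (x ∷ xs) (suc i) = nth xs i

at : List ℕ → ℕ → ℕ
at σ i = nth σ (pred i)

nth-∈ : ∀ xs k → k < length xs → nth xs k ∈ xs
nth-∈ (x ∷ xs) zero    _        = here refl
nth-∈ (x ∷ xs) (suc k) (s≤s k<) = there (nth-∈ xs k k<)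

nth-injective : ∀ xs → Unique xs → ∀ j k → j < length xs → k < length xs → nth xs j ≡ nth xs k → j ≡ k
nth-injective (x ∷ xs) _          zero    zero    _        _        _  = refl
nth-injective (x ∷ xs) (x∉ ∷ _)   zero    (suc k) _        (s≤s k<) eq = ⊥-elim (All.lookup x∉ (nth-∈ xs k k<) eq)
nth-injective (x ∷ xs) (x∉ ∷ _)   (suc j) zero    (s≤s j<) _        eq = ⊥-elim (All.lookup x∉ (nth-∈ xs j j<) (sym eq))
nth-injective (x ∷ xs) (_ ∷ uxs)  (suc j) (suc k) (s≤s j<) (s≤s k<) eq = cong suc (nth-injective xs uxs j k j< k< eq)

nth-extensional : ∀ xs ys → length xs ≡ length ys → (∀ k → k < length xs → nth xs k ≡ nth ys k) → xs ≡ ys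
nth-extensional []       []       _   _  = refl
nth-extensional (x ∷ xs) (y ∷ ys) len eq =
  cong₂ _∷_ (eq zero (s≤s z≤n)) (nth-extensional xs ys (suc-injective len) (λ k k< → eq (suc k) (s≤s k<)))

pred-< : ∀ {N i} (σ : List ℕ) → length σ ≡ N → InRange N i → pred i < length σ
pred-< {i = suc i} σ refl (_ , i<) = i<

at-InRange : ∀ {N σ i} → IsPerm N σ → InRange N i → InRange N (at σ i)
at-InRange {σ = σ} {i} (len , σ-in , _) i-in = All.lookup σ-in (nth-∈ σ (pred i) (pred-< σ len i-in))

at-injective : ∀ {N σ i j} → IsPerm N σ → InRange N i → InRange N j → at σ i ≡ at σ j → i ≡ j
at-injective {σ = σ} {suc i} {suc j} (len , _ , uσ) i-in j-in eq =
  cong suc (nth-injective σ uσ i j (pred-< σ len i-in) (pred-< σ len j-in) eq)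

∘-perm : ∀ {N π σ} → IsPerm N π → IsPerm N σ → IsPerm N (map (at σ) π)
∘-perm {π = π} (len , π-in , uπ) σ-perm =
  trans (length-map _ π) len , AllP.map⁺ (All.map (at-InRange σ-perm) π-in) ,
  map-unique uπ (λ a∈ b∈ → at-injective σ-perm (All.lookup π-in a∈) (All.lookup π-in b∈))

∘-injective : ∀ {N π σ σ′} → IsPerm N π → IsPerm N σ → IsPerm N σ′ → map (at σ) π ≡ map (at σ′) π → σ ≡ σ′
∘-injective {N} {π} {σ} {σ′} (len , π-in , uπ) (len₁ , _) (len₂ , _) eq =
  nth-extensional σ σ′ (trans len₁ (sym len₂)) (λ k k< → map-≡⇒pointwise eq (suc-k∈π k (subst (k <_) len₁ k<)))
  where
  suc-k∈π : ∀ k → k < N → suc k ∈ π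
  suc-k∈π k k< = unique-⊆-complete uπ (λ z∈ → range-complete (All.lookup π-in z∈))
                   (trans len (sym (length-range N))) (range-complete (s≤s z≤n , k<))

⊕-perm : ∀ {n₁ n₂ ρ₁ ρ₂} → IsPerm n₁ ρ₁ → IsPerm n₂ ρ₂ → IsPerm (n₁ + n₂) (ρ₁ ++ map (n₁ +_) ρ₂)
⊕-perm {n₁} {n₂} {ρ₁} {ρ₂} (len₁ , ρ₁-in , uρ₁) (len₂ , ρ₂-in , uρ₂) =
  trans (length-++ ρ₁) (cong₂ _+_ len₁ (trans (length-map _ ρ₂) len₂)) ,
  AllP.++⁺ (All.map (λ (0< , ≤n₁) → 0< , ≤-trans ≤n₁ (m≤m+n n₁ n₂)) ρ₁-in)
           (AllP.map⁺ (All.map (λ {v} (0< , ≤n₂) → <-≤-trans 0< (m≤n+m v n₁) , +-monoʳ-≤ n₁ ≤n₂) ρ₂-in)) ,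
  UP.++⁺ uρ₁ (UP.map⁺ (+-cancelˡ-≡ n₁ _ _) uρ₂) disjoint
  where
  disjoint : ∀ {v} → ¬ (v ∈ ρ₁ × v ∈ map (n₁ +_) ρ₂)
  disjoint (v∈₁ , v∈₂) with ∈-map⁻ (n₁ +_) v∈₂
  ... | w , w∈ , refl = <⇒≱ (m<m+n n₁ (proj₁ (All.lookup ρ₂-in w∈))) (proj₂ (All.lookup ρ₁-in v∈₁))

take-++ : ∀ (xs ys : List A) {k} → length xs ≡ k → take k (xs ++ ys) ≡ xs
take-++ []       ys refl = refl
take-++ (x ∷ xs) ys refl = cong (x ∷_) (take-++ xs ys refl)

drop-++ : ∀ (xs ys : List A) {k} → length xs ≡ k → drop k (xs ++ ys) ≡ ys
drop-++ []       ys refl = refl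
drop-++ (x ∷ xs) ys refl = drop-++ xs ys refl

shuffle : ∀ n₁ n₂ (a b : List ℕ → ℕ) → Invariant n₁ a → Invariant n₂ b →
  n₁ ! * (n₂ ! * sum (map (λ σ → a (take n₁ σ) * b (drop n₁ σ)) (perms (n₁ + n₂))))
  ≡ (n₁ + n₂) ! * (sum (map a (perms n₁)) * sum (map b (perms n₂)))
shuffle n₁ n₂ a b a-inv b-inv = begin
  n₁ ! * (n₂ ! * sum (map weight S))
    ≡⟨ cong₂ (λ x y → x * (y * sum (map weight S))) (length-perms n₁) (length-perms n₂) ⟨
  length S₁ * (length S₂ * sum (map weight S)) ≡⟨ fixing-ρ ⟨
  triples                                      ≡⟨ fixing-σ ⟩
  length S * (sum (map a S₁) * sum (map b S₂)) ≡⟨ cong (_* (sum (map a S₁) * sum (map b S₂))) (length-perms N) ⟩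
  N ! * (sum (map a S₁) * sum (map b S₂))      ∎
  where
  open ≡-Reasoning
  N = n₁ + n₂
  S = perms N
  S₁ = perms n₁
  S₂ = perms n₂
  weight : List ℕ → ℕ
  weight σ = a (take n₁ σ) * b (drop n₁ σ)
  weight∘ : List ℕ → List ℕ → List ℕ → ℕ
  weight∘ σ ρ₁ ρ₂ = weight (map (at σ) (ρ₁ ++ map (n₁ +_) ρ₂))
  triples : ℕ
  triples = sum (map (λ σ → sum (map (λ ρ₁ → sum (map (weight∘ σ ρ₁) S₂)) S₁)) S)

  -- For fixed ρ₁, ρ₂, precomposition with ρ₁ ⊕ ρ₂ permutes S_N.
  fixed-ρ : ∀ {ρ₁ ρ₂} → ρ₁ ∈ S₁ → ρ₂ ∈ S₂ → sum (map (λ σ → weight∘ σ ρ₁ ρ₂) S) ≡ sum (map weight S)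
  fixed-ρ {ρ₁} {ρ₂} ρ₁∈ ρ₂∈ = sum-reindex weight (λ σ → map (at σ) π) (perms-unique N)
      (λ σ∈ → perms-complete N (∘-perm π-perm (perms-sound N σ∈)))
      (λ σ∈ σ′∈ → ∘-injective π-perm (perms-sound N σ∈) (perms-sound N σ′∈))
    where
    π = ρ₁ ++ map (n₁ +_) ρ₂
    π-perm : IsPerm N π
    π-perm = ⊕-perm (perms-sound n₁ ρ₁∈) (perms-sound n₂ ρ₂∈)

  fixing-ρ : triples ≡ length S₁ * (length S₂ * sum (map weight S))
  fixing-ρ = trans (sum-swap S S₁ _) (trans (sum-cong {xs = S₁} (λ {ρ₁} ρ₁∈ →
               trans (sum-swap S S₂ (λ σ → weight∘ σ ρ₁))
                 (trans (sum-cong {xs = S₂} (fixed-ρ ρ₁∈)) (sum-const _ S₂))))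
             (sum-const _ S₁))

  halves : ∀ σ {ρ₁} ρ₂ → ρ₁ ∈ S₁ → weight∘ σ ρ₁ ρ₂ ≡ a (map (at σ) ρ₁) * b (map (at σ ∘ (n₁ +_)) ρ₂)
  halves σ {ρ₁} ρ₂ ρ₁∈ = cong₂ (λ u v → a u * b v)
    (trans (cong (take n₁) (map-++ (at σ) ρ₁ _)) (take-++ (map (at σ) ρ₁) _ len))
    (trans (cong (drop n₁) (map-++ (at σ) ρ₁ _)) (trans (drop-++ (map (at σ) ρ₁) _ len) (sym (map-∘ ρ₂))))
    where
    len : length (map (at σ) ρ₁) ≡ n₁
    len = trans (length-map _ ρ₁) (proj₁ (perms-sound n₁ ρ₁∈))

  -- For fixed σ, both halves are relabellings by injective maps.
  fixed-σ : ∀ {σ} → σ ∈ S → sum (map (λ ρ₁ → sum (map (weight∘ σ ρ₁) S₂)) S₁) ≡ sum (map a S₁) * sum (map b S₂)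
  fixed-σ {σ} σ∈ =
    trans (sum-cong {xs = S₁} (λ ρ₁∈ → sum-cong {xs = S₂} (λ {ρ₂} _ → halves σ ρ₂ ρ₁∈)))
    (trans (sum-product S₁ S₂ (λ ρ₁ → a (map (at σ) ρ₁)) (λ ρ₂ → b (map (at σ ∘ (n₁ +_)) ρ₂)))
      (cong₂ _*_ (relabel-sum n₁ a a-inv (at σ) (λ x-in y-in → at-injective σ-perm (left x-in) (left y-in)))
                 (relabel-sum n₂ b b-inv (at σ ∘ (n₁ +_))
                    (λ x-in y-in eq → +-cancelˡ-≡ n₁ _ _ (at-injective σ-perm (right x-in) (right y-in) eq)))))
    where
    σ-perm = perms-sound N σ∈
    left : ∀ {x} → InRange n₁ x → InRange N x
    left (0< , ≤n₁) = 0< , ≤-trans ≤n₁ (m≤m+n n₁ n₂)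
    right : ∀ {x} → InRange n₂ x → InRange N (n₁ + x)
    right {x} (0< , ≤n₂) = <-≤-trans 0< (m≤n+m x n₁) , +-monoʳ-≤ n₁ ≤n₂

  fixing-σ : triples ≡ length S * (sum (map a S₁) * sum (map b S₂))
  fixing-σ = trans (sum-cong {xs = S} fixed-σ) (sum-const _ S)

-- Peaks only see relative order.

⌊⌋-⇔ : ∀ {X Y : Set} (X? : Dec X) (Y? : Dec Y) → (X → Y) → (Y → X) → ⌊ X? ⌋ ≡ ⌊ Y? ⌋
⌊⌋-⇔ (yes _) (yes _) _ _ = refl
⌊⌋-⇔ (yes x) (no ¬y) f _ = ⊥-elim (¬y (f x))
⌊⌋-⇔ (no ¬x) (yes y) _ g = ⊥-elim (¬x (g y))
⌊⌋-⇔ (no _)  (no _)  _ _ = refl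

peaksFrom-invariant : ∀ n (f g : ℕ → ℕ) → OrderCompatible n f g → ∀ i ρ → All (InRange n) ρ →
  peaksFrom i (map f ρ) ≡ peaksFrom i (map g ρ)
peaksFrom-invariant n f g fg i []          _ = refl
peaksFrom-invariant n f g fg i (x ∷ [])    _ = refl
peaksFrom-invariant n f g fg i (x ∷ _ ∷ []) _ = refl
peaksFrom-invariant n f g fg i (x ∷ t@(y ∷ z ∷ _)) (x-in ∷ t-in@(y-in ∷ z-in ∷ _)) =
  cong₂ (λ C R → if C then i ∷ R else R)
    (cong₂ _∧_ (⌊⌋-⇔ (f x <? f y) (g x <? g y) (proj₁ (fg x-in y-in)) (proj₂ (fg x-in y-in)))
               (⌊⌋-⇔ (f z <? f y) (g z <? g y) (proj₁ (fg z-in y-in)) (proj₂ (fg z-in y-in))))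
    (peaksFrom-invariant n f g fg (suc i) t t-in)

peakComp-invariant : ∀ n (f g : ℕ → ℕ) → OrderCompatible n f g → ∀ ρ → All (InRange n) ρ →
  peakComp (map f ρ) ≡ peakComp (map g ρ)
peakComp-invariant n f g fg ρ ρ-in = cong₂ (λ ps len → diffs 0 (ps ++ [ len ]))
  (peaksFrom-invariant n f g fg 2 ρ ρ-in) (trans (length-map f ρ) (sym (length-map g ρ)))

-- A composition c corresponds to its list of partial sums; peakComp w ≡ c
-- says exactly that the peak positions of w followed by length w are the
-- partial sums of c.

partialSums : ℕ → List ℕ → List ℕ
partialSums p []      = []
partialSums p (x ∷ c) = (p + x) ∷ partialSums (p + x) c

Ascending : ℕ → List ℕ → Set
Ascending p []       = ⊤
Ascending p (x ∷ xs) = p ≤ x × Ascending x xs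

diffs-partialSums : ∀ p c → diffs p (partialSums p c) ≡ c
diffs-partialSums p []      = refl
diffs-partialSums p (x ∷ c) = cong₂ _∷_ (m+n∸m≡n p x) (diffs-partialSums (p + x) c)

partialSums-diffs : ∀ p xs → Ascending p xs → partialSums p (diffs p xs) ≡ xs
partialSums-diffs p []       _            = refl
partialSums-diffs p (x ∷ xs) (p≤x , asc) rewrite m+[n∸m]≡n p≤x = cong (x ∷_) (partialSums-diffs x xs asc)

Ascending-if : ∀ C p i R k → p ≤ i → Ascending i (R ++ [ k ]) → Ascending p (R ++ [ k ]) →
  Ascending p ((if C then i ∷ R else R) ++ [ k ])
Ascending-if true  p i R k p≤i asc _   = p≤i , asc
Ascending-if false p i R k p≤i _   asc = asc

-- The peak positions of w, followed by length w, ascend: peaks are at least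
-- one apart and at most length w − 1.
peaks-ascending : ∀ p i w k → p ≤ i → i + length w ≤ k + 2 → p ≤ k → Ascending p (peaksFrom i w ++ [ k ])
peaks-ascending p i []                  k _   _   p≤k = p≤k , tt
peaks-ascending p i (_ ∷ [])            k _   _   p≤k = p≤k , tt
peaks-ascending p i (_ ∷ _ ∷ [])        k _   _   p≤k = p≤k , tt
peaks-ascending p i (a ∷ t@(b ∷ c ∷ r)) k p≤i len p≤k =
  Ascending-if (⌊ a <? b ⌋ ∧ ⌊ c <? b ⌋) p i (peaksFrom (suc i) t) k p≤i
    (peaks-ascending i (suc i) t k (n≤1+n i) len′ i≤k)
    (peaks-ascending p (suc i) t k (m≤n⇒m≤1+n p≤i) len′ p≤k)
  where
  len′ : suc i + length t ≤ k + 2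
  len′ = subst (_≤ k + 2) (+-suc i (length t)) len
  i≤k : i ≤ k
  i≤k = <⇒≤ (+-cancelʳ-≤ 2 (suc i) k (≤-trans (≤-reflexive (sym (+-suc i 2)))
          (≤-trans (+-monoʳ-≤ i (m≤m+n 3 (length r))) len)))

peakComp⇒positions : ∀ w c → peakComp w ≡ c → peaksFrom 2 w ++ [ length w ] ≡ partialSums 0 c
peakComp⇒positions w c eq =
  trans (sym (partialSums-diffs 0 _ (peaks-ascending 0 2 w (length w) z≤n (≤-reflexive (+-comm 2 (length w))) z≤n)))
        (cong (partialSums 0) eq)

positions⇒peakComp : ∀ w c → peaksFrom 2 w ++ [ length w ] ≡ partialSums 0 c → peakComp w ≡ c
positions⇒peakComp w c eq = trans (cong (diffs 0) eq) (diffs-partialSums 0 c)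

partialSums-++ : ∀ p c d → partialSums p (c ++ d) ≡ partialSums p c ++ partialSums (p + size c) d
partialSums-++ p []      d = cong (λ q → partialSums q d) (sym (+-identityʳ p))
partialSums-++ p (x ∷ c) d = cong ((p + x) ∷_) (trans (partialSums-++ (p + x) c d)
  (cong (λ q → partialSums (p + x) c ++ partialSums q d) (+-assoc p x (size c))))

partialSums-shift : ∀ k p c → partialSums (k + p) c ≡ map (k +_) (partialSums p c)
partialSums-shift k p []      = refl
partialSums-shift k p (x ∷ c) = cong₂ _∷_ (+-assoc k p x)
  (trans (cong (λ q → partialSums q c) (+-assoc k p x)) (partialSums-shift k (p + x) c))

partialSums-≤ : ∀ p c → All (_≤ p + size c) (partialSums p c)
partialSums-≤ p []      = []
partialSums-≤ p (x ∷ c) = subst (p + x ≤_) (+-assoc p x (size c)) (m≤m+n (p + x) (size c))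
  ∷ All.map (λ le → ≤-trans le (≤-reflexive (+-assoc p x (size c)))) (partialSums-≤ (p + x) c)

partialSums-≥ : ∀ p c → All (p ≤_) (partialSums p c)
partialSums-≥ p []      = []
partialSums-≥ p (x ∷ c) = m≤m+n p x ∷ All.map (≤-trans (m≤m+n p x)) (partialSums-≥ (p + x) c)

partialSums-last : ∀ p c → c ≢ [] → p + size c ∈ partialSums p c
partialSums-last p []                ne = ⊥-elim (ne refl)
partialSums-last p (x ∷ [])          _  = here (cong (p +_) (+-identityʳ x))
partialSums-last p (x ∷ c@(_ ∷ _)) _  =
  there (subst (_∈ partialSums (p + x) c) (+-assoc p x (size c)) (partialSums-last (p + x) c (λ ())))

peakAt : ℕ → ℕ → List ℕ → List ℕ
peakAt i x (y ∷ z ∷ _) = if ⌊ x <? y ⌋ ∧ ⌊ z <? y ⌋ then [ i ] else []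
peakAt i x _           = []

peaksFrom-∷ : ∀ i x t → peaksFrom i (x ∷ t) ≡ peakAt i x t ++ peaksFrom (suc i) t
peaksFrom-∷ i x []          = refl
peaksFrom-∷ i x (_ ∷ [])    = refl
peaksFrom-∷ i x (y ∷ z ∷ t) with ⌊ x <? y ⌋ ∧ ⌊ z <? y ⌋
... | true  = refl
... | false = refl

peakAt-position : ∀ {i x t y} → y ∈ peakAt i x t → y ≡ i
peakAt-position {i} {x} {a ∷ b ∷ t} y∈ with ⌊ x <? a ⌋ ∧ ⌊ b <? a ⌋
peakAt-position (here y≡i) | true = y≡i

peakAt-shape : ∀ {i x a b t y} → y ∈ peakAt i x (a ∷ b ∷ t) → x < a × b < a
peakAt-shape {i} {x} {a} {b} y∈ with x <? a | b <? a
... | yes x<a | yes b<a = x<a , b<a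

peakAt-no-ascent : ∀ {i x y z t} → ¬ x < y → peakAt i x (y ∷ z ∷ t) ≡ []
peakAt-no-ascent {x = x} {y} x≮y with x <? y
... | yes x<y = ⊥-elim (x≮y x<y)
... | no _    = refl

peakAt-no-descent : ∀ {i x y z t} → ¬ z < y → peakAt i x (y ∷ z ∷ t) ≡ []
peakAt-no-descent {x = x} {y} {z} z≮y with x <? y | z <? y
... | _     | yes z<y = ⊥-elim (z≮y z<y)
... | yes _ | no _    = refl
... | no _  | no _    = refl

All-peakAt : ∀ {P : ℕ → Set} {i x t} → P i → All P (peakAt i x t)
All-peakAt {P} {i} {x} {t} p = All.tabulate (λ y∈ → subst P (sym (peakAt-position {i} {x} {t} y∈)) p)

peaksFrom-bounds : ∀ i w → All (λ x → i ≤ x × x + 3 ≤ i + length w) (peaksFrom i w)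
peaksFrom-bounds i []           = []
peaksFrom-bounds i (_ ∷ [])     = []
peaksFrom-bounds i (_ ∷ _ ∷ []) = []
peaksFrom-bounds i (a ∷ t@(b ∷ c ∷ _)) = subst (All _) (sym (peaksFrom-∷ i a t))
  (AllP.++⁺ (All-peakAt {i = i} {a} {t} (≤-refl , +-monoʳ-≤ i (s≤s (s≤s (s≤s z≤n)))))
            (All.map (λ (i<x , x+3≤) → ≤-trans (n≤1+n i) i<x , ≤-trans x+3≤ (≤-reflexive (sym (+-suc i (length t)))))
                     (peaksFrom-bounds (suc i) t)))

peaksFrom-shift : ∀ k i w → peaksFrom (k + i) w ≡ map (k +_) (peaksFrom i w)
peaksFrom-shift k i []          = refl
peaksFrom-shift k i (_ ∷ [])    = refl
peaksFrom-shift k i (_ ∷ _ ∷ []) = refl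
peaksFrom-shift k i (a ∷ t@(b ∷ c ∷ _)) = begin
  peaksFrom (k + i) (a ∷ t)                         ≡⟨ peaksFrom-∷ (k + i) a t ⟩
  peakAt (k + i) a t ++ peaksFrom (suc (k + i)) t   ≡⟨ cong₂ _++_ (shift-peakAt k i a t)
                                                          (trans (cong (λ j → peaksFrom j t) (sym (+-suc k i)))
                                                                 (peaksFrom-shift k (suc i) t)) ⟩
  map (k +_) (peakAt i a t) ++ map (k +_) (peaksFrom (suc i) t) ≡⟨ map-++ (k +_) (peakAt i a t) _ ⟨
  map (k +_) (peakAt i a t ++ peaksFrom (suc i) t)  ≡⟨ cong (map (k +_)) (peaksFrom-∷ i a t) ⟨
  map (k +_) (peaksFrom i (a ∷ t))                  ∎
  where
  open ≡-Reasoning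
  shift-peakAt : ∀ k i a t → peakAt (k + i) a t ≡ map (k +_) (peakAt i a t)
  shift-peakAt k i a (b ∷ c ∷ _) with ⌊ a <? b ⌋ ∧ ⌊ c <? b ⌋
  ... | true  = refl
  ... | false = refl
  shift-peakAt k i a []       = refl
  shift-peakAt k i a (_ ∷ []) = refl

peakAt-++ : ∀ i x w a b v → peakAt i x (w ++ a ∷ b ∷ v) ≡ peakAt i x (w ++ a ∷ b ∷ [])
peakAt-++ i x []          a b v = refl
peakAt-++ i x (_ ∷ [])    a b v = refl
peakAt-++ i x (_ ∷ _ ∷ _) a b v = refl

peaksFrom-++ : ∀ i w a b v →
  peaksFrom i (w ++ a ∷ b ∷ v) ≡ peaksFrom i (w ++ a ∷ b ∷ []) ++ peaksFrom (length w + i) (a ∷ b ∷ v)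
peaksFrom-++ i []      a b v = refl
peaksFrom-++ i (x ∷ w) a b v = begin
  peaksFrom i (x ∷ w ++ a ∷ b ∷ v)
    ≡⟨ peaksFrom-∷ i x (w ++ a ∷ b ∷ v) ⟩
  peakAt i x (w ++ a ∷ b ∷ v) ++ peaksFrom (suc i) (w ++ a ∷ b ∷ v)
    ≡⟨ cong₂ _++_ (peakAt-++ i x w a b v) (peaksFrom-++ (suc i) w a b v) ⟩
  peakAt i x w′ ++ peaksFrom (suc i) w′ ++ peaksFrom (length w + suc i) (a ∷ b ∷ v)
    ≡⟨ ++-assoc (peakAt i x w′) (peaksFrom (suc i) w′) _ ⟨
  (peakAt i x w′ ++ peaksFrom (suc i) w′) ++ peaksFrom (length w + suc i) (a ∷ b ∷ v)
    ≡⟨ cong₂ _++_ (sym (peaksFrom-∷ i x w′)) (cong (λ j → peaksFrom j (a ∷ b ∷ v)) (+-suc (length w) i)) ⟩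
  peaksFrom i (x ∷ w′) ++ peaksFrom (suc (length w + i)) (a ∷ b ∷ v) ∎
  where
  open ≡-Reasoning
  w′ = w ++ a ∷ b ∷ []

last-peak-descent : ∀ i w a b x → x ∈ peaksFrom i (w ++ a ∷ b ∷ []) → suc x ≡ i + length w → b < a
last-peak-descent i []      a b x () _
last-peak-descent i (y ∷ w) a b x x∈ eq
  with ∈-++⁻ (peakAt i y (w ++ a ∷ b ∷ [])) (subst (x ∈_) (peaksFrom-∷ i y (w ++ a ∷ b ∷ [])) x∈)
... | inj₂ x∈′ = last-peak-descent (suc i) w a b x x∈′ (trans eq (+-suc i (length w)))
... | inj₁ x∈h with peakAt-position {i} {y} {w ++ a ∷ b ∷ []} x∈h
last-peak-descent i (y ∷ [])    a b x _ _  | inj₁ x∈h | _ = proj₂ (peakAt-shape {i} {y} {a} {b} {[]} x∈h)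
last-peak-descent i (y ∷ z ∷ w) a b x _ eq | inj₁ _   | refl =
  ⊥-elim (m≢1+m+n i (suc-injective (trans eq (trans (+-suc i (suc (length w))) (cong suc (+-suc i (length w)))))))

first-peak-ascent : ∀ i p q t → i ∈ peaksFrom i (p ∷ q ∷ t) → p < q
first-peak-ascent i p q t i∈ with ∈-++⁻ (peakAt i p (q ∷ t)) (subst (i ∈_) (peaksFrom-∷ i p (q ∷ t)) i∈)
first-peak-ascent i p q (r ∷ t) _ | inj₁ i∈h = proj₁ (peakAt-shape {i} {p} {q} {r} {t} i∈h)
... | inj₂ i∈′ = ⊥-elim (1+n≰n (proj₁ (All.lookup (peaksFrom-bounds (suc i) (q ∷ t)) i∈′)))

++-split-at : ∀ {B} xs xs′ ys ys′ → All (_< B) xs → All (_< B) xs′ → All (B ≤_) ys → All (B ≤_) ys′ →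
  xs ++ ys ≡ xs′ ++ ys′ → xs ≡ xs′ × ys ≡ ys′
++-split-at []       []         ys       ys′        _        _         _        _        eq = refl , eq
++-split-at []       (x′ ∷ xs′) (y ∷ ys) ys′        _        (x′<B ∷ _) (B≤y ∷ _) _      eq =
  ⊥-elim (<⇒≱ x′<B (subst (_ ≤_) (∷-injectiveˡ eq) B≤y))
++-split-at (x ∷ xs) []         ys       (y′ ∷ ys′) (x<B ∷ _) _        _        (B≤y′ ∷ _) eq =
  ⊥-elim (<⇒≱ x<B (subst (_ ≤_) (sym (∷-injectiveˡ eq)) B≤y′))
++-split-at (x ∷ xs) (x′ ∷ xs′) ys       ys′        (_ ∷ xs<) (_ ∷ xs′<) ys≥   ys′≥       eq
  with ∷-injectiveˡ eq | ++-split-at xs xs′ ys ys′ xs< xs′< ys≥ ys′≥ (∷-injectiveʳ eq)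
... | refl | xs≡ , ys≡ = cong (x ∷_) xs≡ , ys≡

-- Peaks of a concatenation u ++ v: the peaks of u, then "boundary" peaks at
-- positions |u| and |u|+1 (the last letter of u and the first of v), then the
-- peaks of v shifted by |u|.  If u ends in a descent after its last possible
-- peak and v rises at its start, there are no boundary peaks.
PeakSplit : List ℕ → List ℕ → Set
PeakSplit u v = Σ (List ℕ) λ boundary →
  (peaksFrom 2 (u ++ v) ≡ peaksFrom 2 u ++ boundary ++ peaksFrom (length u + 2) v) ×
  All (λ x → length u ≤ x × x < length u + 2) boundary ×
  ((2 ≤ length u → pred (length u) ∈ peaksFrom 2 u) → length u + 2 ∈ peaksFrom (length u + 2) v → boundary ≡ [])

split-last-two : ∀ (x y : ℕ) u → ∃ λ w → ∃ λ a → ∃ λ b → x ∷ y ∷ u ≡ w ++ a ∷ b ∷ []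
split-last-two x y []      = [] , x , y , refl
split-last-two x y (z ∷ u) with split-last-two y z u
... | w , a , b , eq = x ∷ w , a , b , cong (x ∷_) eq

peakSplit-singleton : ∀ a p q v → PeakSplit (a ∷ []) (p ∷ q ∷ v)
peakSplit-singleton a p q v =
  peakAt 2 a (p ∷ q ∷ v) , peaksFrom-∷ 2 a (p ∷ q ∷ v) ,
  All-peakAt {i = 2} {a} {p ∷ q ∷ v} (s≤s z≤n , s≤s (s≤s (s≤s z≤n))) ,
  λ _ rise → peakAt-no-descent {2} {a} {p} {q} {v} (<⇒≯ (first-peak-ascent 3 p q v rise))

peakSplit-long : ∀ w a b p q v → PeakSplit (w ++ a ∷ b ∷ []) (p ∷ q ∷ v)
peakSplit-long w a b p q v = boundary , peaks≡ , bounded , empty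
  where
  n = length (w ++ a ∷ b ∷ [])
  n≡ : n ≡ length w + 2
  n≡ = length-++ w
  v′ = p ∷ q ∷ v
  atA = peakAt (length w + 2) a (b ∷ v′)
  atB = peakAt (suc (length w + 2)) b v′
  boundary = atA ++ atB
  peaksU = peaksFrom 2 (w ++ a ∷ b ∷ [])
  start : suc (suc (length w + 2)) ≡ n + 2
  start = trans (+-comm 2 (length w + 2)) (cong (_+ 2) (sym n≡))
  peaks≡ : peaksFrom 2 ((w ++ a ∷ b ∷ []) ++ v′) ≡ peaksU ++ boundary ++ peaksFrom (n + 2) v′
  peaks≡ = begin
    peaksFrom 2 ((w ++ a ∷ b ∷ []) ++ v′)          ≡⟨ cong (peaksFrom 2) (++-assoc w (a ∷ b ∷ []) v′) ⟩
    peaksFrom 2 (w ++ a ∷ b ∷ v′)                  ≡⟨ peaksFrom-++ 2 w a b v′ ⟩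
    peaksU ++ peaksFrom (length w + 2) (a ∷ b ∷ v′) ≡⟨ cong (peaksU ++_) (trans (peaksFrom-∷ _ a (b ∷ v′))
                                                         (cong (atA ++_) (peaksFrom-∷ _ b v′))) ⟩
    peaksU ++ atA ++ atB ++ peaksFrom (suc (suc (length w + 2))) v′
                                                   ≡⟨ cong (λ j → peaksU ++ atA ++ atB ++ peaksFrom j v′) start ⟩
    peaksU ++ atA ++ atB ++ peaksFrom (n + 2) v′   ≡⟨ cong (peaksU ++_) (++-assoc atA atB _) ⟨
    peaksU ++ boundary ++ peaksFrom (n + 2) v′     ∎
    where open ≡-Reasoning
  bounded : All (λ x → n ≤ x × x < n + 2) boundary
  bounded = AllP.++⁺
    (All-peakAt {i = length w + 2} {a} {b ∷ v′}
       (≤-reflexive n≡ , subst (length w + 2 <_) (cong (_+ 2) (sym n≡)) (m<m+n (length w + 2) (s≤s z≤n))))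
    (All-peakAt {i = suc (length w + 2)} {b} {v′}
       (≤-trans (≤-reflexive n≡) (n≤1+n _) ,
        subst (suc (length w + 2) <_) (cong (_+ 2) (sym n≡)) (subst (suc (length w + 2) <_) (sym (+-comm (length w + 2) 2)) ≤-refl)))
  empty : (2 ≤ n → pred n ∈ peaksU) → n + 2 ∈ peaksFrom (n + 2) v′ → boundary ≡ []
  empty peakU peakV = cong₂ _++_ (peakAt-no-ascent {length w + 2} {a} {b} {p} {q ∷ v} (<⇒≯ b<a))
                                 (peakAt-no-descent {suc (length w + 2)} {b} {p} {q} {v} (<⇒≯ p<q))
    where
    p<q : p < q
    p<q = first-peak-ascent (n + 2) p q v peakV
    b<a : b < a
    b<a = last-peak-descent 2 w a b (pred n) (peakU (subst (2 ≤_) (sym n≡) (m≤n+m 2 (length w))))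
            (cong (λ k → suc (pred k)) (trans n≡ (+-comm (length w) 2)))

peakSplit : ∀ u v → 1 ≤ length u → 2 ≤ length v → PeakSplit u v
peakSplit []          _           ()  _
peakSplit _           []          _   ()
peakSplit _           (_ ∷ [])    _   (s≤s ())
peakSplit (a ∷ [])    (p ∷ q ∷ v) _ _ = peakSplit-singleton a p q v
peakSplit (x ∷ y ∷ u) (p ∷ q ∷ v) _ _ with split-last-two x y u
... | w , a , b , eq = subst (λ u′ → PeakSplit u′ (p ∷ q ∷ v)) (sym eq) (peakSplit-long w a b p q v)

partialSums-nonempty : ∀ p c → c ≢ [] → partialSums p c ≢ []
partialSums-nonempty p []      c≢ε = ⊥-elim (c≢ε refl)
partialSums-nonempty p (_ ∷ _) _   = λ ()

-- Gluing peak compositions.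
-- For |u| = |c| + 1 and |v| = |d| + 2 with d ≠ ε:
--   peakComp (u ++ v) ≡ c ⊕ (3) ⊕ d  ⇔  peakComp u ≡ c ⊕ (1)  and  peakComp v ≡ (2) ⊕ d.
-- In positions: the left side says the peaks of u ++ v are the partial sums
-- of c (all < |u|) followed by |u|+2 and the partial sums of d shifted by
-- |u|+2; the threshold |u| separates the peaks of u from the boundary and
-- shifted peaks of v, so both sides can be compared piecewise.
module Gluing (c d : Composition) (d≢ε : d ≢ []) (u v : List ℕ)
              (len-u : length u ≡ suc (size c)) (len-v : length v ≡ suc (suc (size d))) where

  n N : ℕ
  n = length u
  N = n + length v

  split : PeakSplit u v
  split = peakSplit u v (subst (1 ≤_) (sym len-u) (s≤s z≤n)) (subst (2 ≤_) (sym len-v) (s≤s (s≤s z≤n)))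

  peaksU peaksV boundary posC posD : List ℕ
  peaksU = peaksFrom 2 u
  peaksV = peaksFrom (n + 2) v
  boundary = proj₁ split
  posC = partialSums 0 c
  posD = (n + 2) ∷ partialSums (n + 2) d

  boundary-bounds : All (λ x → n ≤ x × x < n + 2) boundary
  boundary-bounds = proj₁ (proj₂ (proj₂ split))

  positions-glued : partialSums 0 (c ++ 3 ∷ d) ≡ posC ++ posD
  positions-glued = trans (partialSums-++ 0 c (3 ∷ d))
    (cong (λ j → posC ++ j ∷ partialSums j d) (trans (+-suc (size c) 2) (cong (_+ 2) (sym len-u))))

  positions-left : partialSums 0 (c ++ 1 ∷ []) ≡ posC ++ [ n ]
  positions-left = trans (partialSums-++ 0 c (1 ∷ [])) (cong (λ j → posC ++ [ j ]) (trans (+-comm (size c) 1) (sym len-u)))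

  left⇒ : peakComp u ≡ c ++ 1 ∷ [] → peaksU ≡ posC
  left⇒ eq = ∷ʳ-injectiveˡ peaksU posC (trans (peakComp⇒positions u _ eq) positions-left)

  left⇐ : peaksU ≡ posC → peakComp u ≡ c ++ 1 ∷ []
  left⇐ eq = positions⇒peakComp u _ (trans (cong (_++ [ n ]) eq) (sym positions-left))

  shifted-peaks : map (n +_) (peaksFrom 2 v ++ [ length v ]) ≡ peaksV ++ [ N ]
  shifted-peaks = trans (map-++ (n +_) (peaksFrom 2 v) [ length v ]) (cong (_++ [ N ]) (sym (peaksFrom-shift n 2 v)))

  shifted-positions : map (n +_) (partialSums 0 (2 ∷ d)) ≡ posD
  shifted-positions = cong ((n + 2) ∷_) (sym (partialSums-shift n 2 d))

  right⇒ : peakComp v ≡ 2 ∷ d → peaksV ++ [ N ] ≡ posD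
  right⇒ eq = trans (sym shifted-peaks) (trans (cong (map (n +_)) (peakComp⇒positions v _ eq)) shifted-positions)

  right⇐ : peaksV ++ [ N ] ≡ posD → peakComp v ≡ 2 ∷ d
  right⇐ eq = positions⇒peakComp v _
    (map-injective (+-cancelˡ-≡ n _ _) (trans shifted-peaks (trans eq (sym shifted-positions))))

  glued : peaksFrom 2 (u ++ v) ++ [ N ] ≡ peaksU ++ boundary ++ peaksV ++ [ N ]
  glued = trans (cong (_++ [ N ]) (proj₁ (proj₂ split)))
    (trans (++-assoc peaksU (boundary ++ peaksV) [ N ]) (cong (peaksU ++_) (++-assoc boundary peaksV [ N ])))

  length-glued : length (u ++ v) ≡ N
  length-glued = length-++ u

  peaksU-below : All (_< n) peaksU
  peaksU-below = All.map (λ {x} (_ , x+3≤) → ≤-pred (≤-pred (subst (_≤ 2 + n) (+-comm x 3) x+3≤)))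
                         (peaksFrom-bounds 2 u)

  posC-below : All (_< n) posC
  posC-below = All.map (λ le → subst (_ <_) (sym len-u) (s≤s le)) (partialSums-≤ 0 c)

  posD-above : All (n + 2 ≤_) posD
  posD-above = ≤-refl ∷ partialSums-≥ (n + 2) d

  peaksV-above : All (n + 2 ≤_) (peaksV ++ [ N ])
  peaksV-above = AllP.++⁺ (All.map proj₁ (peaksFrom-bounds (n + 2) v))
                          (+-monoʳ-≤ n (subst (2 ≤_) (sym len-v) (s≤s (s≤s z≤n))) ∷ [])

  n≤ : ∀ {x} → n + 2 ≤ x → n ≤ x
  n≤ = ≤-trans (m≤m+n n 2)

  glued⇒ : peakComp (u ++ v) ≡ c ++ 3 ∷ d → peakComp u ≡ c ++ 1 ∷ [] × peakComp v ≡ 2 ∷ d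
  glued⇒ eq = left⇐ (proj₁ splitU) , right⇐ (proj₂ splitV)
    where
    positions : peaksU ++ (boundary ++ peaksV ++ [ N ]) ≡ posC ++ posD
    positions = trans (sym glued) (trans (cong (λ k → peaksFrom 2 (u ++ v) ++ [ k ]) (sym length-glued))
                  (trans (peakComp⇒positions (u ++ v) _ eq) positions-glued))
    splitU : peaksU ≡ posC × boundary ++ peaksV ++ [ N ] ≡ posD
    splitU = ++-split-at peaksU posC (boundary ++ peaksV ++ [ N ]) posD peaksU-below posC-below
               (AllP.++⁺ (All.map proj₁ boundary-bounds) (All.map n≤ peaksV-above)) (All.map n≤ posD-above) positions
    splitV : boundary ≡ [] × peaksV ++ [ N ] ≡ posD
    splitV = ++-split-at boundary [] (peaksV ++ [ N ]) posD (All.map proj₂ boundary-bounds) [] peaksV-above posD-above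
               (proj₂ splitU)

  glued⇐ : peakComp u ≡ c ++ 1 ∷ [] × peakComp v ≡ 2 ∷ d → peakComp (u ++ v) ≡ c ++ 3 ∷ d
  glued⇐ (eq-u , eq-v) = positions⇒peakComp (u ++ v) _ (begin
    peaksFrom 2 (u ++ v) ++ [ length (u ++ v) ] ≡⟨ cong (λ k → peaksFrom 2 (u ++ v) ++ [ k ]) length-glued ⟩
    peaksFrom 2 (u ++ v) ++ [ N ]               ≡⟨ glued ⟩
    peaksU ++ boundary ++ peaksV ++ [ N ]       ≡⟨ cong (λ B → peaksU ++ B ++ peaksV ++ [ N ]) no-boundary ⟩
    peaksU ++ peaksV ++ [ N ]                   ≡⟨ cong₂ _++_ peaksU≡ (right⇒ eq-v) ⟩
    posC ++ posD                                ≡⟨ positions-glued ⟨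
    partialSums 0 (c ++ 3 ∷ d)                  ∎)
    where
    open ≡-Reasoning
    peaksU≡ : peaksU ≡ posC
    peaksU≡ = left⇒ eq-u
    c≢ε : 2 ≤ n → c ≢ []
    c≢ε 2≤n refl = <⇒≱ 2≤n (≤-reflexive len-u)
    last-peak-u : 2 ≤ n → pred n ∈ peaksU
    last-peak-u 2≤n = subst₂ _∈_ (cong pred (sym len-u)) (sym peaksU≡) (partialSums-last 0 c (c≢ε 2≤n))
    first-peak-v : n + 2 ∈ peaksV
    first-peak-v with peaksV | right⇒ eq-v
    ... | []    | eq = ⊥-elim (non-empty (sym (∷-injectiveʳ eq)))
      where
      non-empty : partialSums (n + 2) d ≢ []
      non-empty = partialSums-nonempty (n + 2) d d≢ε
    ... | _ ∷ _ | eq = here (sym (∷-injectiveˡ eq))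
    no-boundary : boundary ≡ []
    no-boundary = proj₂ (proj₂ (proj₂ split)) last-peak-u first-peak-v

peakComp-glue : ∀ c d → d ≢ [] → ∀ u v → length u ≡ suc (size c) → length v ≡ suc (suc (size d)) →
  (peakComp (u ++ v) ≡ c ++ 3 ∷ d → peakComp u ≡ c ++ 1 ∷ [] × peakComp v ≡ 2 ∷ d) ×
  (peakComp u ≡ c ++ 1 ∷ [] × peakComp v ≡ 2 ∷ d → peakComp (u ++ v) ≡ c ++ 3 ∷ d)
peakComp-glue c d d≢ε u v len-u len-v = glued⇒ , glued⇐
  where open Gluing c d d≢ε u v len-u len-v

-- The gluing identity for P.
-- P c counts σ ∈ S_{|c|} with peak composition c, i.e. sums the invariant
-- statistic "peakComp σ ≡ c".  By `peakComp-glue` the statistic of c ⊕ (3) ⊕ d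
-- is the product of the statistics of c ⊕ (1) on the first |c|+1 letters and
-- of (2) ⊕ d on the rest, so the shuffle identity gives
--   (|c|+1)! (|d|+2)! P(c ⊕ (3) ⊕ d) = (|c|+|d|+3)! P(c ⊕ (1)) P((2) ⊕ d).

hasPeakComp : Composition → List ℕ → ℕ
hasPeakComp c σ = indicator (≡-dec _≟_ (peakComp σ) c)

P-as-sum : ∀ c → P c ≡ sum (map (hasPeakComp c) (perms (size c)))
P-as-sum c = length-filter-indicator (λ σ → ≡-dec _≟_ (peakComp σ) c) (perms (size c))

hasPeakComp-invariant : ∀ n c → Invariant n (hasPeakComp c)
hasPeakComp-invariant n c f g ρ fg ρ-in = cong (λ w → indicator (≡-dec _≟_ w c)) (peakComp-invariant n f g fg ρ ρ-in)

P-glue : ∀ c d → d ≢ [] →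
  (suc (size c)) ! * ((size (2 ∷ d)) ! * P (c ++ 3 ∷ d))
  ≡ (size (c ++ 3 ∷ d)) ! * (P (c ++ 1 ∷ []) * P (2 ∷ d))
P-glue c d d≢ε = begin
  n₁ ! * (n₂ ! * P cG)
    ≡⟨ cong (λ k → n₁ ! * (n₂ ! * k)) (trans (P-as-sum cG) (cong (λ k → sum (map (hasPeakComp cG) (perms k))) size-cG)) ⟩
  n₁ ! * (n₂ ! * sum (map (hasPeakComp cG) (perms N)))
    ≡⟨ cong (λ k → n₁ ! * (n₂ ! * k)) (sum-cong {xs = perms N} factorise) ⟩
  n₁ ! * (n₂ ! * sum (map splitWeight (perms N)))
    ≡⟨ shuffle n₁ n₂ (hasPeakComp cL) (hasPeakComp cR) (hasPeakComp-invariant n₁ cL) (hasPeakComp-invariant n₂ cR) ⟩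
  N ! * (sum (map (hasPeakComp cL) (perms n₁)) * sum (map (hasPeakComp cR) (perms n₂)))
    ≡⟨ cong₂ (λ k l → k ! * (l * sum (map (hasPeakComp cR) (perms n₂)))) (sym size-cG)
             (trans (cong (λ k → sum (map (hasPeakComp cL) (perms k))) (sym size-cL)) (sym (P-as-sum cL))) ⟩
  (size cG) ! * (P cL * sum (map (hasPeakComp cR) (perms n₂)))
    ≡⟨ cong (λ k → (size cG) ! * (P cL * k)) (P-as-sum cR) ⟨
  (size cG) ! * (P cL * P cR) ∎
  where
  open ≡-Reasoning
  cG cL cR : Composition
  cG = c ++ 3 ∷ d
  cL = c ++ 1 ∷ []
  cR = 2 ∷ d
  n₁ n₂ N : ℕ
  n₁ = suc (size c)
  n₂ = size cR
  N = n₁ + n₂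
  size-cG : size cG ≡ N
  size-cG = trans (sum-++ c (3 ∷ d)) (+-suc (size c) n₂)
  size-cL : size cL ≡ n₁
  size-cL = trans (sum-++ c (1 ∷ [])) (+-comm (size c) 1)
  splitWeight : List ℕ → ℕ
  splitWeight σ = hasPeakComp cL (take n₁ σ) * hasPeakComp cR (drop n₁ σ)
  factorise : ∀ {σ} → σ ∈ perms N → hasPeakComp cG σ ≡ splitWeight σ
  factorise {σ} σ∈ = trans (cong (hasPeakComp cG) (sym (take++drop≡id n₁ σ)))
    (indicator-× (≡-dec _≟_ (peakComp (u ++ v)) cG) (≡-dec _≟_ (peakComp u) cL) (≡-dec _≟_ (peakComp v) cR)
                 (proj₁ (peakComp-glue c d d≢ε u v len-take len-drop))
                 (proj₂ (peakComp-glue c d d≢ε u v len-take len-drop)))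
    where
    u v : List ℕ
    u = take n₁ σ
    v = drop n₁ σ
    len-σ : length σ ≡ N
    len-σ = proj₁ (perms-sound N σ∈)
    len-take : length u ≡ n₁
    len-take = trans (length-take n₁ σ) (trans (cong (n₁ ⊓_) len-σ) (m≤n⇒m⊓n≡m (m≤m+n n₁ n₂)))
    len-drop : length v ≡ n₂
    len-drop = trans (length-drop n₁ σ) (trans (cong (_∸ n₁) len-σ) (m+n∸m≡n n₁ n₂))

-- Peeling off runs of threes.

cancel-through : ∀ α β γ D Q R Z → 0 < D → α * (D * Q) ≡ β * R → γ * R ≡ D * Z → α * γ * Q ≡ β * Z
cancel-through α β γ D Q R Z D>0 first second = *-cancelʳ-≡ (α * γ * Q) (β * Z) D {{>-nonZero D>0}} (begin
  α * γ * Q * D   ≡⟨ regroup₁ α γ Q D ⟩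
  γ * (α * (D * Q)) ≡⟨ cong (γ *_) first ⟩
  γ * (β * R)     ≡⟨ regroup₂ γ β R ⟩
  β * (γ * R)     ≡⟨ cong (β *_) second ⟩
  β * (D * Z)     ≡⟨ regroup₃ β D Z ⟩
  β * Z * D       ∎)
  where
  open ≡-Reasoning
  regroup₁ : ∀ α γ Q D → α * γ * Q * D ≡ γ * (α * (D * Q))
  regroup₁ = solve-∀
  regroup₂ : ∀ γ β R → γ * (β * R) ≡ β * (γ * R)
  regroup₂ = solve-∀
  regroup₃ : ∀ β D Z → β * (D * Z) ≡ β * Z * D
  regroup₃ = solve-∀

-- Gluing with c = (2), where P(2,1) = 2: one more leading 3 after the initial 2.
P-prepend-three : ∀ d → d ≢ [] → 3 * ((size (2 ∷ d)) ! * P (2 ∷ 3 ∷ d)) ≡ (size (2 ∷ 3 ∷ d)) ! * P (2 ∷ d)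
P-prepend-three d d≢ε = *-cancelˡ-≡ (3 * (F * Q)) (G * R) 2 (begin
  2 * (3 * (F * Q)) ≡⟨ *-assoc 2 3 (F * Q) ⟨
  6 * (F * Q)       ≡⟨ P-glue (2 ∷ []) d d≢ε ⟩
  G * (2 * R)       ≡⟨ regroup G R ⟩
  2 * (G * R)       ∎)
  where
  open ≡-Reasoning
  F G Q R : ℕ
  F = (size (2 ∷ d)) !
  G = (size (2 ∷ 3 ∷ d)) !
  Q = P (2 ∷ 3 ∷ d)
  R = P (2 ∷ d)
  regroup : ∀ G R → G * (2 * R) ≡ 2 * (G * R)
  regroup = solve-∀

++-nonempty : ∀ (xs : List A) {ys} → ys ≢ [] → xs ++ ys ≢ []
++-nonempty []      ys≢ε = ys≢ε
++-nonempty (_ ∷ _) _    = λ ()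

P-prepend-threes : ∀ j W → W ≢ [] →
  3 ^ j * ((size (2 ∷ W)) ! * P (2 ∷ threes j ++ W)) ≡ (size (2 ∷ threes j ++ W)) ! * P (2 ∷ W)
P-prepend-threes zero    W W≢ε = *-identityˡ _
P-prepend-threes (suc j) W W≢ε =
  subst (_≡ (size (2 ∷ 3 ∷ d)) ! * P (2 ∷ W)) (regroup 3 (3 ^ j) ((size (2 ∷ W)) !) (P (2 ∷ 3 ∷ d)))
    (cancel-through 3 ((size (2 ∷ 3 ∷ d)) !) (3 ^ j * (size (2 ∷ W)) !) ((size (2 ∷ d)) !)
       (P (2 ∷ 3 ∷ d)) (P (2 ∷ d)) (P (2 ∷ W)) (1≤n! (size (2 ∷ d)))
       (P-prepend-three d (++-nonempty (threes j) W≢ε))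
       (trans (*-assoc (3 ^ j) _ _) (P-prepend-threes j W W≢ε)))
  where
  d : Composition
  d = threes j ++ W
  regroup : ∀ a b c e → a * (b * c) * e ≡ a * b * (c * e)
  regroup = solve-∀

P-block : ∀ c j W → W ≢ [] →
  3 ^ j * ((suc (size c)) ! * ((size (2 ∷ W)) ! * P (c ++ threes (suc j) ++ W)))
  ≡ (size (c ++ threes (suc j) ++ W)) ! * (P (c ++ 1 ∷ []) * P (2 ∷ W))
P-block c j W W≢ε =
  subst₂ _≡_ (regroup ((suc (size c)) !) (3 ^ j) ((size (2 ∷ W)) !) (P (c ++ 3 ∷ d)))
             (*-assoc ((size (c ++ 3 ∷ d)) !) (P (c ++ 1 ∷ [])) (P (2 ∷ W)))
    (cancel-through ((suc (size c)) !) ((size (c ++ 3 ∷ d)) ! * P (c ++ 1 ∷ [])) (3 ^ j * (size (2 ∷ W)) !)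
       ((size (2 ∷ d)) !) (P (c ++ 3 ∷ d)) (P (2 ∷ d)) (P (2 ∷ W)) (1≤n! (size (2 ∷ d)))
       (trans (P-glue c d (++-nonempty (threes j) W≢ε)) (sym (*-assoc ((size (c ++ 3 ∷ d)) !) (P (c ++ 1 ∷ [])) (P (2 ∷ d)))))
       (trans (*-assoc (3 ^ j) _ _) (P-prepend-threes j W W≢ε)))
  where
  d : Composition
  d = threes j ++ W
  regroup : ∀ a e f q → a * (e * f) * q ≡ e * (a * (f * q))
  regroup = solve-∀

blocks : (m : ℕ) → (Fin m → ℕ) → (Fin (suc m) → Composition) → Composition
blocks m ℓ c = concatF m (λ i → c (inject₁ i) ++ threes (ℓ i)) ++ c (fromℕ m)

blocks-suc : ∀ m ℓ c → blocks (suc m) ℓ c ≡ c zero ++ threes (ℓ zero) ++ blocks m (ℓ ∘ suc) (c ∘ suc)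
blocks-suc m ℓ c = trans (++-assoc (c zero ++ threes (ℓ zero)) _ _) (++-assoc (c zero) (threes (ℓ zero)) _)

withTwo : ∀ {m} → (Fin (suc m) → Composition) → Fin (suc m) → Composition
withTwo c zero    = 2 ∷ c zero
withTwo c (suc i) = c (suc i)

blocks-withTwo : ∀ m ℓ c → blocks m ℓ (withTwo c) ≡ 2 ∷ blocks m ℓ c
blocks-withTwo zero    ℓ c = refl
blocks-withTwo (suc m) ℓ c = refl

size-threes : ∀ j → size (threes j) ≡ 3 * j
size-threes zero    = refl
size-threes (suc j) = trans (cong (3 +_) (size-threes j)) (sym (*-suc 3 j))

size-blocks : ∀ m ℓ c → size (blocks m ℓ c) ≡ 3 * sumF m ℓ + sumF (suc m) (size ∘ c)
size-blocks zero    ℓ c = sym (+-identityʳ (size (c zero)))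
size-blocks (suc m) ℓ c = begin
  size (blocks (suc m) ℓ c)                                           ≡⟨ cong size (blocks-suc m ℓ c) ⟩
  size (c zero ++ threes (ℓ zero) ++ rest)                            ≡⟨ sum-++ (c zero) _ ⟩
  size (c zero) + size (threes (ℓ zero) ++ rest)                      ≡⟨ cong (size (c zero) +_) (sum-++ (threes (ℓ zero)) rest) ⟩
  size (c zero) + (size (threes (ℓ zero)) + size rest)                ≡⟨ cong₂ (λ x y → size (c zero) + (x + y))
                                                                           (size-threes (ℓ zero)) (size-blocks m (ℓ ∘ suc) (c ∘ suc)) ⟩
  size (c zero) + (3 * ℓ zero + (3 * sumF m (ℓ ∘ suc) + sumF (suc m) (size ∘ c ∘ suc)))
                                                                      ≡⟨ regroup (size (c zero)) (ℓ zero) _ _ ⟩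
  3 * sumF (suc m) ℓ + sumF (suc (suc m)) (size ∘ c)                  ∎
  where
  open ≡-Reasoning
  rest : Composition
  rest = blocks m (ℓ ∘ suc) (c ∘ suc)
  regroup : ∀ s l a b → s + (3 * l + (3 * a + b)) ≡ 3 * (l + a) + (s + b)
  regroup = solve-∀

sumF-≥ : ∀ m (ℓ : Fin m → ℕ) → (∀ i → 1 ≤ ℓ i) → m ≤ sumF m ℓ
sumF-≥ zero    ℓ ℓ≥1 = z≤n
sumF-≥ (suc m) ℓ ℓ≥1 = +-mono-≤ (ℓ≥1 zero) (sumF-≥ m (ℓ ∘ suc) (ℓ≥1 ∘ suc))

exponent-split : ∀ m (ℓ : Fin (suc m) → ℕ) j → ℓ zero ≡ suc j → (∀ i → 1 ≤ ℓ i) →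
  3 ^ (sumF (suc m) ℓ ∸ suc m) ≡ 3 ^ j * 3 ^ (sumF m (ℓ ∘ suc) ∸ m)
exponent-split m ℓ j ℓ₀≡ ℓ≥1 = begin
  3 ^ (ℓ zero + sumF m (ℓ ∘ suc) ∸ suc m) ≡⟨ cong (λ x → 3 ^ (x + sumF m (ℓ ∘ suc) ∸ suc m)) ℓ₀≡ ⟩
  3 ^ (j + sumF m (ℓ ∘ suc) ∸ m)          ≡⟨ cong (3 ^_) (+-∸-assoc j (sumF-≥ m (ℓ ∘ suc) (ℓ≥1 ∘ suc))) ⟩
  3 ^ (j + (sumF m (ℓ ∘ suc) ∸ m))        ≡⟨ ^-distribˡ-+-* 3 j _ ⟩
  3 ^ j * 3 ^ (sumF m (ℓ ∘ suc) ∸ m)      ∎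
  where open ≡-Reasoning

1≤⇒suc : ∀ {n} → 1 ≤ n → Σ ℕ λ j → n ≡ suc j
1≤⇒suc {suc j} _ = j , refl

first-block : ∀ m (ℓ : Fin (suc m) → ℕ) (c : Fin (suc (suc m)) → Composition) →
  (∀ i → 1 ≤ ℓ i) → c (fromℕ (suc m)) ≢ [] →
  let W = blocks m (ℓ ∘ suc) (c ∘ suc) in
  3 ^ (sumF (suc m) ℓ ∸ suc m) * ((1 + size (c zero)) ! * ((size (2 ∷ W)) ! * P (blocks (suc m) ℓ c)))
  ≡ 3 ^ (sumF m (ℓ ∘ suc) ∸ m)
    * ((3 * sumF (suc m) ℓ + sumF (suc (suc m)) (size ∘ c)) ! * (P (c zero ++ 1 ∷ []) * P (2 ∷ W)))
first-block m ℓ c ℓ≥1 last≢ε with 1≤⇒suc (ℓ≥1 zero)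
... | j , ℓ₀≡ = begin
  3 ^ (sumF (suc m) ℓ ∸ suc m) * (L * (F * P word))      ≡⟨ cong₂ (λ e w → e * (L * (F * P w)))
                                                              (exponent-split m ℓ j ℓ₀≡ ℓ≥1) word≡ ⟩
  3 ^ j * E * (L * (F * P (c zero ++ threes (suc j) ++ W))) ≡⟨ regroup (3 ^ j) E L (F * P (c zero ++ threes (suc j) ++ W)) ⟩
  E * (3 ^ j * (L * (F * P (c zero ++ threes (suc j) ++ W)))) ≡⟨ cong (E *_) (P-block (c zero) j W W≢ε) ⟩
  E * ((size (c zero ++ threes (suc j) ++ W)) ! * (P (c zero ++ 1 ∷ []) * P (2 ∷ W)))
                                                          ≡⟨ cong (λ w → E * ((size w) ! * (P (c zero ++ 1 ∷ []) * P (2 ∷ W))))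
                                                               (sym word≡) ⟩
  E * ((size word) ! * (P (c zero ++ 1 ∷ []) * P (2 ∷ W))) ≡⟨ cong (λ n → E * (n ! * (P (c zero ++ 1 ∷ []) * P (2 ∷ W))))
                                                               (size-blocks (suc m) ℓ c) ⟩
  E * ((3 * sumF (suc m) ℓ + sumF (suc (suc m)) (size ∘ c)) ! * (P (c zero ++ 1 ∷ []) * P (2 ∷ W))) ∎
  where
  open ≡-Reasoning
  W word : Composition
  W = blocks m (ℓ ∘ suc) (c ∘ suc)
  word = blocks (suc m) ℓ c
  L F E : ℕ
  L = (1 + size (c zero)) !
  F = (size (2 ∷ W)) !
  E = 3 ^ (sumF m (ℓ ∘ suc) ∸ m)
  W≢ε : W ≢ []
  W≢ε = ++-nonempty (concatF m _) last≢ε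
  word≡ : word ≡ c zero ++ threes (suc j) ++ W
  word≡ = trans (blocks-suc m ℓ c) (cong (λ l → c zero ++ threes l ++ W) ℓ₀≡)
  regroup : ∀ e E a x → e * E * (a * x) ≡ E * (e * (a * x))
  regroup = solve-∀

step-algebra : ∀ e E A F Q T PA Z C Π L P₃ ΠP Zₗ → 0 < F →
  e * (A * (F * Q)) ≡ E * (T * (PA * Z)) → E * Z * (C * Π * L) ≡ F * P₃ * ΠP * Zₗ →
  e * Q * (A * (C * Π) * L) ≡ T * PA * (P₃ * ΠP) * Zₗ
step-algebra e E A F Q T PA Z C Π L P₃ ΠP Zₗ F>0 first rest =
  trans (regroup₁ e Q A C Π L)
    (trans (cancel-through (e * A) (T * PA) (C * Π * L) F Q (E * Z) (P₃ * ΠP * Zₗ) F>0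
             (trans (regroup₂ e A F Q) (trans first (regroup₃ E T PA Z)))
             (trans (regroup₄ C Π L E Z) (trans rest (regroup₅ F P₃ ΠP Zₗ))))
           (regroup₆ T PA P₃ ΠP Zₗ))
  where
  regroup₁ : ∀ e Q A C Π L → e * Q * (A * (C * Π) * L) ≡ e * A * (C * Π * L) * Q
  regroup₁ = solve-∀
  regroup₂ : ∀ e A F Q → e * A * (F * Q) ≡ e * (A * (F * Q))
  regroup₂ = solve-∀
  regroup₃ : ∀ E T PA Z → E * (T * (PA * Z)) ≡ T * PA * (E * Z)
  regroup₃ = solve-∀
  regroup₄ : ∀ C Π L E Z → C * Π * L * (E * Z) ≡ E * Z * (C * Π * L)
  regroup₄ = solve-∀
  regroup₅ : ∀ F P₃ ΠP Zₗ → F * P₃ * ΠP * Zₗ ≡ F * (P₃ * ΠP * Zₗ)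
  regroup₅ = solve-∀
  regroup₆ : ∀ T PA P₃ ΠP Zₗ → T * PA * (P₃ * ΠP * Zₗ) ≡ T * PA * (P₃ * ΠP) * Zₗ
  regroup₆ = solve-∀

-- The theorem without the (unneeded) positivity of the parts, by induction
-- on the number of runs of threes; the remaining word is handled by the
-- induction hypothesis for the compositions (2) ⊕ c⁽²⁾, c⁽³⁾, …, c⁽ᵏ⁺¹⁾.
P-blocks : (m : ℕ) (ℓ : Fin (suc m) → ℕ) (c : Fin (suc (suc m)) → Composition) →
  (∀ i → 1 ≤ ℓ i) → c (fromℕ (suc m)) ≢ [] →
  3 ^ (sumF (suc m) ℓ ∸ suc m) * P (blocks (suc m) ℓ c)
    * ((1 + size (c zero)) ! * prodF m (λ j → (3 + size (c (suc (inject₁ j)))) !) * (size (c (fromℕ (suc m))) + 2) !)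
  ≡ (3 * sumF (suc m) ℓ + sumF (suc (suc m)) (λ i → size (c i))) ! * P (c zero ++ [ 1 ])
    * prodF m (λ j → P (2 ∷ c (suc (inject₁ j)) ++ [ 1 ])) * P (2 ∷ c (fromℕ (suc m)))
P-blocks zero ℓ c ℓ≥1 last≢ε = begin
  e * Q * (L * 1 * (size (c (suc zero)) + 2) !)    ≡⟨ cong (λ n → e * Q * (L * 1 * n !)) (+-comm (size (c (suc zero))) 2) ⟩
  e * Q * (L * 1 * (2 + size (c (suc zero))) !)    ≡⟨ regroup₁ e Q L _ ⟩
  e * (L * ((2 + size (c (suc zero))) ! * Q))      ≡⟨ first-block zero ℓ c ℓ≥1 last≢ε ⟩
  1 * (T * (PA * Z))                               ≡⟨ regroup₂ T PA Z ⟩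
  T * PA * 1 * Z                                   ∎
  where
  open ≡-Reasoning
  e Q L T PA Z : ℕ
  e = 3 ^ (sumF 1 ℓ ∸ 1)
  Q = P (blocks 1 ℓ c)
  L = (1 + size (c zero)) !
  T = (3 * sumF 1 ℓ + sumF 2 (size ∘ c)) !
  PA = P (c zero ++ [ 1 ])
  Z = P (2 ∷ c (suc zero))
  regroup₁ : ∀ e Q L F → e * Q * (L * 1 * F) ≡ e * (L * (F * Q))
  regroup₁ = solve-∀
  regroup₂ : ∀ T PA Z → 1 * (T * (PA * Z)) ≡ T * PA * 1 * Z
  regroup₂ = solve-∀
P-blocks (suc m) ℓ c ℓ≥1 last≢ε =
  step-algebra e E ((1 + size (c zero)) !) F (P (blocks (suc (suc m)) ℓ c)) T (P (c zero ++ [ 1 ])) (P (2 ∷ W))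
               C Π L P₃ ΠP Zₗ (1≤n! (size (2 ∷ W)))
    (first-block (suc m) ℓ c ℓ≥1 last≢ε)
    (subst₂ (λ w n → E * P w * (C * Π * L) ≡ n ! * P₃ * ΠP * Zₗ)
       (blocks-withTwo (suc m) (ℓ ∘ suc) (c ∘ suc)) size-rest
       (P-blocks m (ℓ ∘ suc) (withTwo (c ∘ suc)) (ℓ≥1 ∘ suc) last≢ε))
  where
  W : Composition
  W = blocks (suc m) (ℓ ∘ suc) (c ∘ suc)
  e F T E C Π L P₃ ΠP Zₗ : ℕ
  e = 3 ^ (sumF (suc (suc m)) ℓ ∸ suc (suc m))
  F = (size (2 ∷ W)) !
  T = (3 * sumF (suc (suc m)) ℓ + sumF (suc (suc (suc m))) (size ∘ c)) !
  E = 3 ^ (sumF (suc m) (ℓ ∘ suc) ∸ suc m)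
  C = (3 + size (c (suc zero))) !
  Π = prodF m (λ j → (3 + size (c (suc (inject₁ (suc j))))) !)
  L = (size (c (fromℕ (suc (suc m)))) + 2) !
  P₃ = P (2 ∷ c (suc zero) ++ [ 1 ])
  ΠP = prodF m (λ j → P (2 ∷ c (suc (inject₁ (suc j))) ++ [ 1 ]))
  Zₗ = P (2 ∷ c (fromℕ (suc (suc m))))
  size-rest : 3 * sumF (suc m) (ℓ ∘ suc) + sumF (suc (suc m)) (size ∘ withTwo (c ∘ suc)) ≡ size (2 ∷ W)
  size-rest = trans (sym (size-blocks (suc m) (ℓ ∘ suc) (withTwo (c ∘ suc))))
                    (cong size (blocks-withTwo (suc m) (ℓ ∘ suc) (c ∘ suc)))

proposition5p5 : (m : ℕ) (ℓ : Fin (suc m) → ℕ) (c : Fin (suc (suc m)) → Composition) →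
    (∀ i → 1 ≤ ℓ i) → (∀ i → IsComposition (c i)) → c (fromℕ (suc m)) ≢ [] →
    3 ^ (sumF (suc m) ℓ ∸ suc m)
      * P (concatF (suc m) (λ i → c (inject₁ i) ++ threes (ℓ i)) ++ c (fromℕ (suc m)))
      * ((1 + size (c zero)) !
         * prodF m (λ j → (3 + size (c (suc (inject₁ j)))) !)
         * (size (c (fromℕ (suc m))) + 2) !)
    ≡ (3 * sumF (suc m) ℓ + sumF (suc (suc m)) (λ i → size (c i))) !
      * P (c zero ++ [ 1 ])
      * prodF m (λ j → P (2 ∷ c (suc (inject₁ j)) ++ [ 1 ]))
      * P (2 ∷ c (fromℕ (suc m)))
proposition5p5 m ℓ c ℓ≥1 _ last≢ε = P-blocks m ℓ c ℓ≥1 last≢ε
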